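{- For every pattern $\alpha\in(\Sigma\cup\Xi)^+$, the non-erasing pattern language $\mathcal{L}_{NE}(\alpha)$ can be maintained in $\mathsf{DynCQ}$.
   Context: Patterns. $\Sigma$ is a finite alphabet and $\Xi$ an infinite set of variables disjoint from $\Sigma$. A pattern is a word over $\Sigma\cup\Xi$. A substitution is a morphism $\sigma:(\Sigma\cup\Xi)^*\to\Sigma^*$ with $\sigma(a)=a$ for $a\in\Sigma$. The non-erasing language of $\alpha$ is $\mathcal{L}_{NE}(\alpha)=\{\sigma(\alpha): \sigma$ a substitution with $\sigma(x)\neq\varepsilon$ for all $x\in\Xi\}$. Dynamic setting. A word-structure has domain $D=\{1,\dots,n+1\}$ ($n\ge0$), the linear order $<$, a constant $\$=n+1$, and for each $\zeta\in\Sigma$ a unary relation $R_\zeta\subseteq\{1,\dots,n\}$, each position in at most one $R_\zeta$. Write $w(i)=\zeta$ if $R_\zeta(i)$ and $w(i)=\varepsilon$ otherwise; the current word is $w=w(1)\cdots w(n)$. Updates $\mathsf{ins}_\zeta(i)$ (set $w(i)=\zeta$) and $\mathsf{reset}(i)$ (set $w(i)=\varepsilon$), $i\le n$, are allowed only if they change the word-structure; initially all positions are $\varepsilon$. A dynamic program has finitely many auxiliary relations over $D$ (possibly 0-ary), initialized by first-order formulas, and for each auxiliary relation $R$ (arity $k$) and each abstract update $\mathsf{op}$ an update formula $\varphi^R_{\mathsf{op}}(y;x_1,\dots,x_k)$; after applying $\mathsf{op}$ at $i$, the new $R$ is the set of $\vec j$ with $\varphi^R_{\mathsf{op}}(i;\vec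 j)$ true in the updated word-structure with the old auxiliary relations. A program maintains a language $L$ if a designated 0-ary auxiliary relation is true exactly when the current word is in $L$, after every sequence of updates. $\mathsf{DynCQ}$: all update formulas are conjunctive queries (built from atoms by conjunction and existential quantification). -}

module Defs where

open import Data.Nat using (ℕ; zero; suc)
open import Data.Fin using (Fin; zero; suc; fromℕ; inject₁; _≟_)
import Data.Fin as F
open import Data.Vec using (Vec; []; _∷_; lookup)
open import Data.List using (List; []; _∷_; [_]; _++_; concatMap)
open import Data.Maybe using (Maybe; just; nothing)
open import Data.Sum using (_⊎_; inj₁; inj₂)
open import Data.Product using (Σ; _×_; _,_)
open import Relation.Binary.PropositionalEquality using (_≡_; _≢_; subst; sym)
open import Relation.Nullary using (¬_; yes; no)
open import Function.Bundles using (_⇔_)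

-- Patterns.  Alphabet Σ = Fin s, variables Ξ = ℕ.

Pattern : ℕ → Set
Pattern s = List (Fin s ⊎ ℕ)

applySub : ∀ {s} → (ℕ → List (Fin s)) → Pattern s → List (Fin s)
applySub σ = concatMap (λ { (inj₁ a) → [ a ] ; (inj₂ x) → σ x })

L-NE : ∀ {s} → Pattern s → List (Fin s) → Set
L-NE {s} α w = Σ (ℕ → List (Fin s)) λ σ → ((x : ℕ) → σ x ≢ []) × (applySub σ α ≡ w)

-- Domain D = Fin (suc n): the element k : Fin (suc n)
-- stands for position k+1; the constant $ = n+1 is fromℕ n.  The input
-- relations R_ζ live on the positions 1..n, given as a map
-- W : Fin n → Maybe (Fin s)  (nothing = ε, just ζ = R_ζ holds).

WordState : ℕ → ℕ → Set
WordState s n = Fin n → Maybe (Fin s)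

Dom : ℕ → Set
Dom n = Fin (suc n)

Lab : ∀ {s n} → WordState s n → Fin s → Dom n → Set
Lab {n = n} W ζ d = Σ (Fin n) λ p → (inject₁ p ≡ d) × (W p ≡ just ζ)

word : ∀ {s n} → WordState s n → List (Fin s)
word {n = zero} W = []
word {n = suc n} W with W zero
... | nothing = word (λ p → W (suc p))
... | just ζ  = ζ ∷ word (λ p → W (suc p))

emptyState : ∀ {s n} → WordState s n
emptyState _ = nothing

-- set position i to v (v = just ζ : ins_ζ(i);  v = nothing : reset(i))
setPos : ∀ {s n} → WordState s n → Fin n → Maybe (Fin s) → WordState s n
setPos W i v p with p ≟ i
... | yes _ = v
... | no  _ = W p

-- Formulas with k free variables (de Bruijn, var zero = most
-- recently bound / first free variable), over the signature
-- {<, $, R_ζ (ζ ∈ Σ)} plus auxiliary relation symbols 0..m-1 with arities ar.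

data Term (k : ℕ) : Set where
  var    : Fin k → Term k
  dollar : Term k

data Atom (s m : ℕ) (ar : Fin m → ℕ) (k : ℕ) : Set where
  _≐_ : Term k → Term k → Atom s m ar k
  _≺_ : Term k → Term k → Atom s m ar k
  lab : Fin s → Term k → Atom s m ar k
  rel : (j : Fin m) → Vec (Term k) (ar j) → Atom s m ar k

data FO (s m : ℕ) (ar : Fin m → ℕ) : ℕ → Set where
  atom  : ∀ {k} → Atom s m ar k → FO s m ar k
  ¬ᶠ_   : ∀ {k} → FO s m ar k → FO s m ar k
  _∧ᶠ_  : ∀ {k} → FO s m ar k → FO s m ar k → FO s m ar k
  _∨ᶠ_  : ∀ {k} → FO s m ar k → FO s m ar k → FO s m ar k
  ∃ᶠ    : ∀ {k} → FO s m ar (suc k) → FO s m ar k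
  ∀ᶠ    : ∀ {k} → FO s m ar (suc k) → FO s m ar k

data CQ (s m : ℕ) (ar : Fin m → ℕ) : ℕ → Set where
  atom  : ∀ {k} → Atom s m ar k → CQ s m ar k
  _∧ᶜ_  : ∀ {k} → CQ s m ar k → CQ s m ar k → CQ s m ar k
  ∃ᶜ    : ∀ {k} → CQ s m ar (suc k) → CQ s m ar k

noAux : Fin 0 → ℕ
noAux ()

AuxInterp : ℕ → (m : ℕ) → (Fin m → ℕ) → Set₁
AuxInterp n m ar = (j : Fin m) → Vec (Dom n) (ar j) → Set

noInterp : ∀ {n} → AuxInterp n 0 noAux
noInterp ()

⟦_⟧ₜ : ∀ {n k} → Term k → Vec (Dom n) k → Dom n
⟦_⟧ₜ {n} (var x) ρ = lookup ρ x
⟦_⟧ₜ {n} dollar  ρ = fromℕ n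

⟦_⟧ₐ : ∀ {s m ar n k} → Atom s m ar k → WordState s n → AuxInterp n m ar
      → Vec (Dom n) k → Set
⟦ t ≐ u ⟧ₐ W I ρ = ⟦ t ⟧ₜ ρ ≡ ⟦ u ⟧ₜ ρ
⟦ t ≺ u ⟧ₐ W I ρ = ⟦ t ⟧ₜ ρ F.< ⟦ u ⟧ₜ ρ
⟦ lab ζ t ⟧ₐ W I ρ = Lab W ζ (⟦ t ⟧ₜ ρ)
⟦ rel j ts ⟧ₐ W I ρ = I j (Data.Vec.map (λ t → ⟦ t ⟧ₜ ρ) ts)

⟦_⟧ᶠ : ∀ {s m ar n k} → FO s m ar k → WordState s n → AuxInterp n m ar
      → Vec (Dom n) k → Set
⟦ atom a ⟧ᶠ W I ρ = ⟦ a ⟧ₐ W I ρ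
⟦ ¬ᶠ φ ⟧ᶠ W I ρ = ¬ ⟦ φ ⟧ᶠ W I ρ
⟦ φ ∧ᶠ ψ ⟧ᶠ W I ρ = ⟦ φ ⟧ᶠ W I ρ × ⟦ ψ ⟧ᶠ W I ρ
⟦ φ ∨ᶠ ψ ⟧ᶠ W I ρ = ⟦ φ ⟧ᶠ W I ρ ⊎ ⟦ ψ ⟧ᶠ W I ρ
⟦_⟧ᶠ {n = n} (∃ᶠ φ) W I ρ = Σ (Dom n) λ d → ⟦ φ ⟧ᶠ W I (d ∷ ρ)
⟦_⟧ᶠ {n = n} (∀ᶠ φ) W I ρ = (d : Dom n) → ⟦ φ ⟧ᶠ W I (d ∷ ρ)

⟦_⟧ᶜ : ∀ {s m ar n k} → CQ s m ar k → WordState s n → AuxInterp n m ar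
      → Vec (Dom n) k → Set
⟦ atom a ⟧ᶜ W I ρ = ⟦ a ⟧ₐ W I ρ
⟦ φ ∧ᶜ ψ ⟧ᶜ W I ρ = ⟦ φ ⟧ᶜ W I ρ × ⟦ ψ ⟧ᶜ W I ρ
⟦_⟧ᶜ {n = n} (∃ᶜ φ) W I ρ = Σ (Dom n) λ d → ⟦ φ ⟧ᶜ W I (d ∷ ρ)

-- Abstract updates: Maybe (Fin s), where just ζ = ins_ζ
-- and nothing = reset.  The update formula for relation j has
-- suc (ar j) free variables: var zero is the update position y,
-- var (suc l) is x_{l+1}.

record DynCQProgram (s : ℕ) : Set where
  field
    m      : ℕ
    ar     : Fin m → ℕ
    init   : (j : Fin m) → FO s 0 noAux (ar j)
    update : Maybe (Fin s) → (j : Fin m) → CQ s m ar (suc (ar j))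
    query  : Fin m
    query0 : ar query ≡ 0

module _ {s : ℕ} (P : DynCQProgram s) where
  open DynCQProgram P

  initAux : ∀ {n} → AuxInterp n m ar
  initAux j xs = ⟦ init j ⟧ᶠ emptyState noInterp xs

  -- new auxiliary relations after applying op at position i;
  -- W' is the already-updated word-structure, I the old auxiliary relations
  stepAux : ∀ {n} → Maybe (Fin s) → Fin n → WordState s n → AuxInterp n m ar
          → AuxInterp n m ar
  stepAux op i W' I j xs = ⟦ update op j ⟧ᶜ W' I (inject₁ i ∷ xs)

  data Reachable (n : ℕ) : WordState s n → AuxInterp n m ar → Set₁ where
    start : Reachable n emptyState initAux
    step  : ∀ {W I} → Reachable n W I → (op : Maybe (Fin s)) (i : Fin n)
          → W i ≢ op
          → Reachable n (setPos W i op) (stepAux op i (setPos W i op) I)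

  Accepts : ∀ {n} → AuxInterp n m ar → Set
  Accepts {n} I = I query (subst (Vec (Dom n)) (sym query0) [])

  Maintains : (List (Fin s) → Set) → Set₁
  Maintains L = ∀ n W I → Reachable n W I → (L (word W) ⇔ Accepts I)

InDynCQ : ∀ {s} → (List (Fin s) → Set) → Set₁
InDynCQ {s} L = Σ (DynCQProgram s) λ P → Maintains P L

module Submission where

-- The program maintains, besides static relations for the order arithmetic around a position
-- (initialised once by first-order formulas, since the order never changes), the relations
-- FactorEq(a, b, c, d) :⇔ a ≤ b ≤ c ≤ d ∧ w[a, b) = w[c, d) and Marked(a) :⇔ a = $ ∨ w(a) ≠ ε.
-- After an update at y, an equation between two disjoint factors is settled by cutting the
-- factor containing y around y, cutting the other one at a guessed point, and comparing the two
-- resulting pairs of factors with the old FactorEq; this is a conjunctive query.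
-- Membership in L_NE(α) is again a conjunctive query over the updated relations: it guesses the
-- boundaries of a left-to-right match of α, reads terminals with R_a, compares the images of
-- repeated variables with FactorEq, and uses FactorEq(p, z, $, $) for the ε-gap [p, z) and
-- Marked for the nonemptiness of fresh variables.

open import Defs
open import Data.Fin using (Fin; zero; suc; toℕ; fromℕ; fromℕ<; inject₁; #_)
open import Data.Fin.Properties using (toℕ-injective; toℕ-inject₁; toℕ-fromℕ<; toℕ-fromℕ; toℕ<n)
open import Data.Nat using (ℕ; zero; suc; _≟_; _+_; _∸_; _≤_; _<_; z≤n; s≤s; z<s; _≤?_; _<?_; s≤s⁻¹)
open import Data.Nat.Properties
open import Data.List using (List; []; _∷_; _++_; [_]; fromMaybe; map)
open import Data.List.Properties using (++-assoc; ++-identityʳ; ∷-injective; ++-conicalˡ; ++-conicalʳ)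
open import Data.Maybe using (Maybe; just; nothing)
open import Data.Sum using (_⊎_; inj₁; inj₂; [_,_]′)
open import Data.Product using (Σ; ∃-syntax; Σ-syntax; _×_; _,_; proj₁; proj₂; map₂)
open import Relation.Binary.PropositionalEquality hiding ([_])
open import Relation.Nullary using (¬_; Dec; yes; no; _×-dec_)
open import Data.Empty using (⊥-elim)
open import Data.Unit using (⊤)
open import Function.Bundles using (_⇔_; mk⇔; Equivalence)
open Equivalence using (to; from)
open import Function.Construct.Identity using (⇔-id)
open import Function.Properties.Equivalence using () renaming (trans to ⇔-trans; sym to ⇔-sym)
open import Function.Related.TypeIsomorphisms using (¬-cong-⇔)
open import Data.Product.Function.NonDependent.Propositional using (_×-⇔_)
open import Data.Sum.Function.Propositional using (_⊎-⇔_)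
open import Data.Vec using (Vec; []; _∷_; lookup; tabulate)

∃-⇔ : ∀ {A : Set} {P Q : A → Set} → (∀ x → P x ⇔ Q x) → Σ A P ⇔ Σ A Q
∃-⇔ P⇔Q = mk⇔ (map₂ λ {x} → to (P⇔Q x)) (map₂ λ {x} → from (P⇔Q x))

module Segment {A : Set} where

  segmentFrom : (ℕ → Maybe A) → ℕ → ℕ → List A
  segmentFrom f a zero    = []
  segmentFrom f a (suc k) = fromMaybe (f a) ++ segmentFrom f (suc a) k

  segment : (ℕ → Maybe A) → ℕ → ℕ → List A
  segment f a b = segmentFrom f a (b ∸ a)

  segmentFrom-cong : ∀ {f g} a k → (∀ p → a ≤ p → p < a + k → f p ≡ g p) →
    segmentFrom f a k ≡ segmentFrom g a k
  segmentFrom-cong a zero    f≗g = refl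
  segmentFrom-cong a (suc k) f≗g =
    cong₂ (λ x l → fromMaybe x ++ l) (f≗g a ≤-refl (m<m+n a z<s))
      (segmentFrom-cong (suc a) k λ p a<p p<a+k →
        f≗g p (<⇒≤ a<p) (subst (p <_) (sym (+-suc a k)) p<a+k))

  segment-cong : ∀ {f g a b} → a ≤ b → (∀ p → a ≤ p → p < b → f p ≡ g p) →
    segment f a b ≡ segment g a b
  segment-cong {a = a} {b} a≤b f≗g =
    segmentFrom-cong a (b ∸ a) λ p a≤p p<b → f≗g p a≤p (subst (p <_) (m+[n∸m]≡n a≤b) p<b)

  segmentFrom-shift : ∀ (f : ℕ → Maybe A) a k →
    segmentFrom f (suc a) k ≡ segmentFrom (λ p → f (suc p)) a k
  segmentFrom-shift f a zero    = refl
  segmentFrom-shift f a (suc k) = cong (fromMaybe (f (suc a)) ++_) (segmentFrom-shift f (suc a) k)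

  segmentFrom-nothing : ∀ {f} → (∀ p → f p ≡ nothing) → ∀ a k → segmentFrom f a k ≡ []
  segmentFrom-nothing f≡nothing a zero    = refl
  segmentFrom-nothing f≡nothing a (suc k) rewrite f≡nothing a = segmentFrom-nothing f≡nothing (suc a) k

  module _ (f : ℕ → Maybe A) where

    segmentFrom-+ : ∀ a k l → segmentFrom f a (k + l) ≡ segmentFrom f a k ++ segmentFrom f (a + k) l
    segmentFrom-+ a zero    l rewrite +-identityʳ a = refl
    segmentFrom-+ a (suc k) l rewrite segmentFrom-+ (suc a) k l | +-suc a k =
      sym (++-assoc (fromMaybe (f a)) _ _)

    segment-++ : ∀ {a b c} → a ≤ b → b ≤ c → segment f a c ≡ segment f a b ++ segment f b c
    segment-++ {a} {b} {c} a≤b b≤c = begin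
      segmentFrom f a (c ∸ a)                ≡⟨ cong (segmentFrom f a) c∸a≡ ⟩
      segmentFrom f a ((b ∸ a) + (c ∸ b))    ≡⟨ segmentFrom-+ a (b ∸ a) (c ∸ b) ⟩
      segment f a b ++ segmentFrom f (a + (b ∸ a)) (c ∸ b)
        ≡⟨ cong (λ z → segment f a b ++ segmentFrom f z (c ∸ b)) (m+[n∸m]≡n a≤b) ⟩
      segment f a b ++ segment f b c         ∎
      where
      open ≡-Reasoning
      c∸a≡ : c ∸ a ≡ (b ∸ a) + (c ∸ b)
      c∸a≡ = trans (cong (_∸ a) (sym (m+[n∸m]≡n b≤c))) (+-∸-comm (c ∸ b) a≤b)

    segment-refl : ∀ a → segment f a a ≡ []
    segment-refl a rewrite n∸n≡0 a = refl

    segment-around : ∀ {a p b} → a ≤ p → p < b →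
      segment f a b ≡ segment f a p ++ fromMaybe (f p) ++ segment f (suc p) b
    segment-around {a} {p} {b} a≤p p<b = begin
      segment f a b                                ≡⟨ segment-++ a≤p (<⇒≤ p<b) ⟩
      segment f a p ++ segment f p b
        ≡⟨ cong (segment f a p ++_) (segment-++ (n≤1+n p) p<b) ⟩
      segment f a p ++ segment f p (suc p) ++ segment f (suc p) b
        ≡⟨ cong (λ z → segment f a p ++ segmentFrom f p z ++ segment f (suc p) b) (m+n∸n≡m 1 p) ⟩
      segment f a p ++ (fromMaybe (f p) ++ []) ++ segment f (suc p) b
        ≡⟨ cong (λ z → segment f a p ++ z ++ segment f (suc p) b) (++-identityʳ (fromMaybe (f p))) ⟩
      segment f a p ++ fromMaybe (f p) ++ segment f (suc p) b ∎
      where open ≡-Reasoning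

    segment-around-just : ∀ {a p b x} → a ≤ p → p < b → f p ≡ just x →
      segment f a b ≡ segment f a p ++ x ∷ segment f (suc p) b
    segment-around-just {a} {p} {b} a≤p p<b fp =
      trans (segment-around a≤p p<b)
            (cong (λ z → segment f a p ++ fromMaybe z ++ segment f (suc p) b) fp)

    segmentFrom-suc : ∀ {a m} → f a ≡ m → ∀ k →
      segmentFrom f a (suc k) ≡ fromMaybe m ++ segmentFrom f (suc a) k
    segmentFrom-suc fa k = cong (λ z → fromMaybe z ++ segmentFrom f _ k) fa

    segmentFrom-split : ∀ a k u v → segmentFrom f a k ≡ u ++ v →
      ∃[ j ] j ≤ k × segmentFrom f a j ≡ u × segmentFrom f (a + j) (k ∸ j) ≡ v
    segmentFrom-split a zero u v eq
      rewrite ++-conicalˡ u v (sym eq) | ++-conicalʳ u v (sym eq) = 0 , z≤n , refl , refl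
    segmentFrom-split a (suc k) u v eq with f a in fa
    ... | nothing with segmentFrom-split (suc a) k u v eq
    ...   | j , j≤k , eq₁ , eq₂ =
            suc j , s≤s j≤k , trans (segmentFrom-suc fa j) eq₁ ,
            trans (cong (λ z → segmentFrom f z (k ∸ j)) (+-suc a j)) eq₂
    segmentFrom-split a (suc k) [] v eq | just x =
      0 , z≤n , refl ,
      trans (cong (λ z → segmentFrom f z (suc k)) (+-identityʳ a)) (trans (segmentFrom-suc fa k) eq)
    segmentFrom-split a (suc k) (y ∷ u) v eq | just x with ∷-injective eq
    ...   | refl , eq′ with segmentFrom-split (suc a) k u v eq′
    ...     | j , j≤k , eq₁ , eq₂ =
              suc j , s≤s j≤k , trans (segmentFrom-suc fa j) (cong (x ∷_) eq₁) ,
              trans (cong (λ z → segmentFrom f z (k ∸ j)) (+-suc a j)) eq₂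

    segment-split : ∀ {a b} u v → a ≤ b → segment f a b ≡ u ++ v →
      ∃[ c ] a ≤ c × c ≤ b × segment f a c ≡ u × segment f c b ≡ v
    segment-split {a} {b} u v a≤b eq with segmentFrom-split a (b ∸ a) u v eq
    ... | j , j≤b∸a , eq₁ , eq₂ =
      a + j , m≤m+n a j , subst (a + j ≤_) (m+[n∸m]≡n a≤b) (+-monoʳ-≤ a j≤b∸a) ,
      trans (cong (segmentFrom f a) (m+n∸m≡n a j)) eq₁ ,
      trans (cong (segmentFrom f (a + j)) (sym (∸-+-assoc b a j))) eq₂

    segmentFrom-first : ∀ a k x v → segmentFrom f a k ≡ x ∷ v →
      ∃[ j ] j < k × segmentFrom f a j ≡ [] × f (a + j) ≡ just x ×
             segmentFrom f (suc (a + j)) (k ∸ suc j) ≡ v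
    segmentFrom-first a (suc k) x v eq with f a in fa
    ... | nothing with segmentFrom-first (suc a) k x v eq
    ...   | j , j<k , eq₁ , fj , eq₂ =
            suc j , s≤s j<k , trans (segmentFrom-suc fa j) eq₁ ,
            subst (λ z → f z ≡ just x) (sym (+-suc a j)) fj ,
            subst (λ z → segmentFrom f (suc z) (k ∸ suc j) ≡ v) (sym (+-suc a j)) eq₂
    segmentFrom-first a (suc k) x v eq | just y with ∷-injective eq
    ...   | refl , eq′ =
            0 , z<s , refl , subst (λ z → f z ≡ just x) (sym (+-identityʳ a)) fa ,
            subst (λ z → segmentFrom f (suc z) k ≡ v) (sym (+-identityʳ a)) eq′

    segment-split-letter : ∀ {a b} u x v → a ≤ b → segment f a b ≡ u ++ x ∷ v →
      ∃[ d ] a ≤ d × d < b × segment f a d ≡ u × f d ≡ just x × segment f (suc d) b ≡ v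
    segment-split-letter {a} {b} u x v a≤b eq with segment-split u (x ∷ v) a≤b eq
    ... | c , a≤c , c≤b , eq₁ , eq₂ with segmentFrom-first c (b ∸ c) x v eq₂
    ...   | j , j<b∸c , eq₃ , fd , eq₄ =
      c + j , ≤-trans a≤c (m≤m+n c j) , c+j<b ,
      trans (segment-++ a≤c (m≤m+n c j))
            (trans (cong₂ _++_ eq₁ (trans (cong (segmentFrom f c) (m+n∸m≡n c j)) eq₃))
                   (++-identityʳ u)) ,
      fd ,
      trans (cong (segmentFrom f (suc (c + j))) b∸c+j+1) eq₄
      where
      c+j<b : c + j < b
      c+j<b = subst (c + j <_) (m+[n∸m]≡n c≤b) (+-monoʳ-< c j<b∸c)
      b∸c+j+1 : b ∸ suc (c + j) ≡ (b ∸ c) ∸ suc j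
      b∸c+j+1 = trans (cong (b ∸_) (sym (+-suc c j))) (sym (∸-+-assoc b c (suc j)))

open Segment

module Labelling {s : ℕ} where

  -- The word-structure as a labelling of ℕ; positions ≥ n, in particular $, carry no letter.
  label : ∀ {n} → WordState s n → ℕ → Maybe (Fin s)
  label {zero}  W p       = nothing
  label {suc n} W zero    = W zero
  label {suc n} W (suc p) = label (λ q → W (suc q)) p

  label-fromℕ< : ∀ {n} (W : WordState s n) {p} (p<n : p < n) → label W p ≡ W (fromℕ< p<n)
  label-fromℕ< {suc n} W {zero}  p<n       = refl
  label-fromℕ< {suc n} W {suc p} (s≤s p<n) = label-fromℕ< (λ q → W (suc q)) p<n

  label-≥ : ∀ {n} (W : WordState s n) {p} → n ≤ p → label W p ≡ nothing
  label-≥ {zero}  W n≤p       = refl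
  label-≥ {suc n} W (s≤s n≤p) = label-≥ (λ q → W (suc q)) n≤p

  label-toℕ : ∀ {n} (W : WordState s n) i → label W (toℕ i) ≡ W i
  label-toℕ {suc n} W zero    = refl
  label-toℕ {suc n} W (suc i) = label-toℕ (λ q → W (suc q)) i

  label-emptyState : ∀ {n} p → label {n} emptyState p ≡ nothing
  label-emptyState {zero}  p       = refl
  label-emptyState {suc n} zero    = refl
  label-emptyState {suc n} (suc p) = label-emptyState {n} p

  setPos-≡ : ∀ {n} (W : WordState s n) i v → setPos W i v i ≡ v
  setPos-≡ W i v with i Data.Fin.≟ i
  ... | yes _  = refl
  ... | no i≢i = ⊥-elim (i≢i refl)

  setPos-≢ : ∀ {n} (W : WordState s n) i v {j} → j ≢ i → setPos W i v j ≡ W j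
  setPos-≢ W i v {j} j≢i with j Data.Fin.≟ i
  ... | yes j≡i = ⊥-elim (j≢i j≡i)
  ... | no  _   = refl

  label-setPos-≡ : ∀ {n} (W : WordState s n) i v → label (setPos W i v) (toℕ i) ≡ v
  label-setPos-≡ W i v = trans (label-toℕ (setPos W i v) i) (setPos-≡ W i v)

  label-setPos-≢ : ∀ {n} (W : WordState s n) i v {p} → p ≢ toℕ i →
    label (setPos W i v) p ≡ label W p
  label-setPos-≢ {n} W i v {p} p≢i with p <? n
  ... | yes p<n = begin
    label (setPos W i v) p    ≡⟨ label-fromℕ< _ p<n ⟩
    setPos W i v (fromℕ< p<n) ≡⟨ setPos-≢ W i v (λ eq → p≢i (trans (sym (toℕ-fromℕ< p<n)) (cong toℕ eq))) ⟩
    W (fromℕ< p<n)            ≡⟨ label-fromℕ< W p<n ⟨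
    label W p                 ∎
    where open ≡-Reasoning
  ... | no p≮n = trans (label-≥ _ (≮⇒≥ p≮n)) (sym (label-≥ W (≮⇒≥ p≮n)))

  word≡segment : ∀ {n} (W : WordState s n) → word W ≡ segment (label W) 0 n
  word≡segment {zero}  W = refl
  word≡segment {suc n} W with W zero
  ... | nothing = trans (word≡segment (λ p → W (suc p))) (sym (segmentFrom-shift (label W) 0 n))
  ... | just ζ  = cong (ζ ∷_) (trans (word≡segment (λ p → W (suc p)))
                                     (sym (segmentFrom-shift (label W) 0 n)))

  Lab⇔label : ∀ {n} (W : WordState s n) ζ d → Lab W ζ d ⇔ (label W (toℕ d) ≡ just ζ)
  Lab⇔label {n} W ζ d = mk⇔ ⇒ ⇐
    where
    ⇒ : Lab W ζ d → label W (toℕ d) ≡ just ζ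
    ⇒ (p , refl , Wp) = trans (cong (label W) (toℕ-inject₁ p)) (trans (label-toℕ W p) Wp)
    ⇐ : label W (toℕ d) ≡ just ζ → Lab W ζ d
    ⇐ eq with toℕ d <? n
    ... | yes d<n = fromℕ< d<n , toℕ-injective (trans (toℕ-inject₁ _) (toℕ-fromℕ< d<n)) ,
                    trans (sym (label-fromℕ< W d<n)) eq
    ... | no  d≮n with () ← trans (sym eq) (label-≥ W (≮⇒≥ d≮n))

  segment-emptyState : ∀ {n} a b → segment (label {n} emptyState) a b ≡ []
  segment-emptyState {n} a b = segmentFrom-nothing (label-emptyState {n}) a (b ∸ a)

module Matching {s : ℕ} where

  Word : Set
  Word = List (Fin s)

  Binding : Set
  Binding = List (ℕ × Word)

  lookupBinding : Binding → ℕ → Maybe Word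
  lookupBinding []             x = nothing
  lookupBinding ((y , u) ∷ E) x with x ≟ y
  ... | yes _ = just u
  ... | no  _ = lookupBinding E x

  -- Left-to-right matching; E holds the images of the variables met so far.
  mutual
    Matches : Pattern s → Binding → Word → Set
    Matches []            E w = w ≡ []
    Matches (inj₁ a ∷ α) E w = Σ Word λ v → w ≡ a ∷ v × Matches α E v
    Matches (inj₂ x ∷ α) E w = MatchesVar x α E w (lookupBinding E x)

    MatchesVar : ℕ → Pattern s → Binding → Word → Maybe Word → Set
    MatchesVar x α E w (just u) = Σ Word λ v → w ≡ u ++ v × Matches α E v
    MatchesVar x α E w nothing  =
      Σ Word λ u → Σ Word λ v → u ≢ [] × w ≡ u ++ v × Matches α ((x , u) ∷ E) v

  lookupBinding-here : ∀ x u E → lookupBinding ((x , u) ∷ E) x ≡ just u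
  lookupBinding-here x u E with x ≟ x
  ... | yes _  = refl
  ... | no x≢x = ⊥-elim (x≢x refl)

  Agrees : (ℕ → Word) → Binding → Set
  Agrees σ E = ∀ x u → lookupBinding E x ≡ just u → σ x ≡ u

  Agrees-∷ : ∀ σ E x → Agrees σ E → Agrees σ ((x , σ x) ∷ E)
  Agrees-∷ σ E x agr y u eq with y ≟ x
  Agrees-∷ σ E x agr y u refl | yes refl = refl
  ... | no _ = agr y u eq

  applySub-Matches : ∀ σ → (∀ x → σ x ≢ []) → ∀ α E → Agrees σ E → Matches α E (applySub σ α)
  applySub-Matches σ σ≢[] []            E agr = refl
  applySub-Matches σ σ≢[] (inj₁ a ∷ α) E agr = _ , refl , applySub-Matches σ σ≢[] α E agr
  applySub-Matches σ σ≢[] (inj₂ x ∷ α) E agr = matchVar (lookupBinding E x) refl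
    where
    matchVar : ∀ m → lookupBinding E x ≡ m → MatchesVar x α E (applySub σ (inj₂ x ∷ α)) m
    matchVar (just u) eq = _ , cong (_++ _) (agr x u eq) , applySub-Matches σ σ≢[] α E agr
    matchVar nothing  eq =
      σ x , _ , σ≢[] x , refl , applySub-Matches σ σ≢[] α ((x , σ x) ∷ E) (Agrees-∷ σ E x agr)

  mutual
    finalBinding : ∀ α E w → Matches α E w → Binding
    finalBinding []            E w _           = E
    finalBinding (inj₁ a ∷ α) E w (v , _ , m) = finalBinding α E v m
    finalBinding (inj₂ x ∷ α) E w m           = finalBindingVar x α E w (lookupBinding E x) m

    finalBindingVar : ∀ x α E w mu → MatchesVar x α E w mu → Binding
    finalBindingVar x α E w (just u) (v , _ , m)         = finalBinding α E v m
    finalBindingVar x α E w nothing  (u , v , _ , _ , m) = finalBinding α ((x , u) ∷ E) v m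

  Extends : Binding → Binding → Set
  Extends E E′ = ∀ x u → lookupBinding E x ≡ just u → lookupBinding E′ x ≡ just u

  Extends-∷ : ∀ E x u → lookupBinding E x ≡ nothing → Extends E ((x , u) ∷ E)
  Extends-∷ E x u unbound y u′ eq with y ≟ x
  ... | yes refl with () ← trans (sym unbound) eq
  ... | no  _ = eq

  mutual
    finalBinding-extends : ∀ α E w (m : Matches α E w) → Extends E (finalBinding α E w m)
    finalBinding-extends []            E w _           x u eq = eq
    finalBinding-extends (inj₁ a ∷ α) E w (v , _ , m) = finalBinding-extends α E v m
    finalBinding-extends (inj₂ x ∷ α) E w m           =
      finalBindingVar-extends x α E w (lookupBinding E x) refl m

    finalBindingVar-extends : ∀ x α E w mu → lookupBinding E x ≡ mu → (m : MatchesVar x α E w mu) →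
      Extends E (finalBindingVar x α E w mu m)
    finalBindingVar-extends x α E w (just u) _       (v , _ , m)         = finalBinding-extends α E v m
    finalBindingVar-extends x α E w nothing  unbound (u , v , _ , _ , m) y u′ eq =
      finalBinding-extends α ((x , u) ∷ E) v m y u′ (Extends-∷ E x u unbound y u′ eq)

  NonErasing : Binding → Set
  NonErasing E = ∀ x u → lookupBinding E x ≡ just u → u ≢ []

  NonErasing-∷ : ∀ E x u → u ≢ [] → NonErasing E → NonErasing ((x , u) ∷ E)
  NonErasing-∷ E x u u≢[] ne y u′ eq with y ≟ x
  NonErasing-∷ E x u u≢[] ne y u′ refl | yes _ = u≢[]
  ... | no _ = ne y u′ eq

  mutual
    finalBinding-nonErasing : ∀ α E w (m : Matches α E w) → NonErasing E →
      NonErasing (finalBinding α E w m)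
    finalBinding-nonErasing []            E w _           ne = ne
    finalBinding-nonErasing (inj₁ a ∷ α) E w (v , _ , m) = finalBinding-nonErasing α E v m
    finalBinding-nonErasing (inj₂ x ∷ α) E w m           =
      finalBindingVar-nonErasing x α E w (lookupBinding E x) m

    finalBindingVar-nonErasing : ∀ x α E w mu (m : MatchesVar x α E w mu) → NonErasing E →
      NonErasing (finalBindingVar x α E w mu m)
    finalBindingVar-nonErasing x α E w (just u) (v , _ , m)            = finalBinding-nonErasing α E v m
    finalBindingVar-nonErasing x α E w nothing  (u , v , u≢[] , _ , m) ne =
      finalBinding-nonErasing α ((x , u) ∷ E) v m (NonErasing-∷ E x u u≢[] ne)

  mutual
    Matches⇒applySub : ∀ σ α E w (m : Matches α E w) → Agrees σ (finalBinding α E w m) →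
      applySub σ α ≡ w
    Matches⇒applySub σ []            E w m             agr = sym m
    Matches⇒applySub σ (inj₁ a ∷ α) E w (v , refl , m) agr = cong (a ∷_) (Matches⇒applySub σ α E v m agr)
    Matches⇒applySub σ (inj₂ x ∷ α) E w m             agr =
      MatchesVar⇒applySub σ x α E w (lookupBinding E x) refl m agr

    MatchesVar⇒applySub : ∀ σ x α E w mu → lookupBinding E x ≡ mu → (m : MatchesVar x α E w mu) →
      Agrees σ (finalBindingVar x α E w mu m) → applySub σ (inj₂ x ∷ α) ≡ w
    MatchesVar⇒applySub σ x α E w (just u) bound (v , refl , m) agr =
      cong₂ _++_ (agr x u (finalBinding-extends α E v m x u bound)) (Matches⇒applySub σ α E v m agr)
    MatchesVar⇒applySub σ x α E w nothing _ (u , v , _ , refl , m) agr =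
      cong₂ _++_ (agr x u (finalBinding-extends α ((x , u) ∷ E) v m x u (lookupBinding-here x u E)))
                 (Matches⇒applySub σ α _ v m agr)

  -- Variables not occurring in the pattern are sent to the arbitrary nonempty word [ d ].
  substitutionOf : Fin s → Binding → ℕ → Word
  substitutionOf d E x with lookupBinding E x
  ... | just u  = u
  ... | nothing = [ d ]

  substitutionOf-agrees : ∀ d E → Agrees (substitutionOf d E) E
  substitutionOf-agrees d E x u eq with lookupBinding E x
  substitutionOf-agrees d E x u refl | just .u = refl

  substitutionOf-nonErasing : ∀ d E → NonErasing E → ∀ x → substitutionOf d E x ≢ []
  substitutionOf-nonErasing d E ne x with lookupBinding E x in eq
  ... | just u  = ne x u eq
  ... | nothing = λ ()

  Matches-letter : ∀ α w → α ≢ [] → Matches α [] w → Fin s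
  Matches-letter []            w α≢[] m = ⊥-elim (α≢[] refl)
  Matches-letter (inj₁ a ∷ α) w _    m = a
  Matches-letter (inj₂ x ∷ α) w _    ([] , v , u≢[] , _ , m) = ⊥-elim (u≢[] refl)
  Matches-letter (inj₂ x ∷ α) w _    (d ∷ u , v , _ , _ , m) = d

  L-NE⇔Matches : ∀ α w → α ≢ [] → L-NE α w ⇔ Matches α [] w
  L-NE⇔Matches α w α≢[] = mk⇔
    (λ { (σ , σ≢[] , refl) → applySub-Matches σ σ≢[] α [] (λ x u ()) })
    (λ m → let d = Matches-letter α w α≢[] m ; E = finalBinding α [] w m in
      substitutionOf d E ,
      substitutionOf-nonErasing d E (finalBinding-nonErasing α [] w m (λ x u ())) ,
      Matches⇒applySub (substitutionOf d E) α [] w m (substitutionOf-agrees d E))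

  Matches-nonempty : ∀ α → α ≢ [] → ¬ Matches α [] []
  Matches-nonempty []            α≢[] _                       = α≢[] refl
  Matches-nonempty (inj₁ a ∷ α) _    (v , () , _)
  Matches-nonempty (inj₂ x ∷ α) _    ([] , v , u≢[] , _ , _)  = u≢[] refl
  Matches-nonempty (inj₂ x ∷ α) _    (_ ∷ _ , v , _ , () , _)

open Labelling
open Matching

module Relations where

  pattern Accept      = zero
  pattern FactorEq    = suc zero
  pattern Marked      = suc (suc zero)
  pattern Succ        = suc (suc (suc zero))
  pattern Min         = suc (suc (suc (suc zero)))
  pattern Neq         = suc (suc (suc (suc (suc zero))))
  pattern Select      = suc (suc (suc (suc (suc (suc zero)))))
  pattern ResetSplit  = suc (suc (suc (suc (suc (suc (suc zero))))))
  pattern InsertSplit = suc (suc (suc (suc (suc (suc (suc (suc zero)))))))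

  arity : Fin 9 → ℕ
  arity Accept      = 0
  arity FactorEq    = 4
  arity Marked      = 1
  arity Succ        = 2
  arity Min         = 1
  arity Neq         = 2
  arity Select      = 3
  arity ResetSplit  = 9
  arity InsertSplit = 10

  module Intended {s n : ℕ} where

    $ : Dom n
    $ = fromℕ n

    Within : Dom n → Dom n → Dom n → Set
    Within y a b = toℕ a ≤ toℕ y × toℕ y < toℕ b

    Ordered : Dom n → Dom n → Dom n → Dom n → Set
    Ordered a b c d = toℕ a ≤ toℕ b × toℕ b ≤ toℕ c × toℕ c ≤ toℕ d

    IsSucc : Dom n → Dom n → Set
    IsSucc a b = toℕ b ≡ suc (toℕ a)

    IsMin : Dom n → Set
    IsMin a = toℕ a ≡ 0

    Selects : Dom n → Dom n → Dom n → Set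
    Selects x y u = (x ≡ y × u ≡ $) ⊎ (x ≢ y × u ≡ x)

    -- How the factors [a,b), [c,d) are cut into [a,y₁), [c,y₂) and [y₁′,b), [y₂′,d) around an
    -- update at y: the interval containing y loses position y. After a reset the other interval
    -- is cut at a single point; after an insertion it loses the position e that matches the new
    -- letter. If neither interval contains y, then e = y, the position holding the new letter.
    ResetSplits : Dom n → Dom n → Dom n → Dom n → Dom n → Dom n → Dom n → Dom n → Dom n → Set
    ResetSplits y a b c d y₁ y₁′ y₂ y₂′ = Ordered a b c d ×
      ((Within y a b × y₁ ≡ y × IsSucc y y₁′ × y₂′ ≡ y₂) ⊎
       (Within y c d × y₂ ≡ y × IsSucc y y₂′ × y₁′ ≡ y₁) ⊎
       (¬ Within y a b × ¬ Within y c d × y₁′ ≡ y₁ × y₂′ ≡ y₂))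

    InsertSplits : Dom n → Dom n → Dom n → Dom n → Dom n → Dom n → Dom n → Dom n → Dom n → Dom n → Set
    InsertSplits y a b c d y₁ y₁′ y₂ y₂′ e = Ordered a b c d ×
      ((Within y a b × y₁ ≡ y × IsSucc y y₁′ × e ≡ y₂ × IsSucc y₂ y₂′) ⊎
       (Within y c d × y₂ ≡ y × IsSucc y y₂′ × e ≡ y₁ × IsSucc y₁ y₁′) ⊎
       (¬ Within y a b × ¬ Within y c d × y₁′ ≡ y₁ × y₂′ ≡ y₂ × e ≡ y))

    FactorsEqual : WordState s n → Dom n → Dom n → Dom n → Dom n → Set
    FactorsEqual W a b c d =
      Ordered a b c d × segment (label W) (toℕ a) (toℕ b) ≡ segment (label W) (toℕ c) (toℕ d)

    IsMarked : WordState s n → Dom n → Set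
    IsMarked W a = a ≡ $ ⊎ ∃[ ζ ] label W (toℕ a) ≡ just ζ

  module FOFormulas {s : ℕ} where

    FO₀ : ℕ → Set
    FO₀ = FO s 0 noAux

    eqᶠ ltᶠ leᶠ succᶠ : ∀ {k} → Fin k → Fin k → FO₀ k
    eqᶠ a b = atom (var a ≐ var b)
    ltᶠ a b = atom (var a ≺ var b)
    leᶠ a b = ltᶠ a b ∨ᶠ eqᶠ a b
    succᶠ a b = ltᶠ a b ∧ᶠ ∀ᶠ (¬ᶠ (ltᶠ (suc a) zero ∧ᶠ ltᶠ zero (suc b)))

    withinᶠ : ∀ {k} → Fin k → Fin k → Fin k → FO₀ k
    withinᶠ y a b = leᶠ a y ∧ᶠ ltᶠ y b

    orderedᶠ : ∀ {k} → Fin k → Fin k → Fin k → Fin k → FO₀ k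
    orderedᶠ a b c d = leᶠ a b ∧ᶠ (leᶠ b c ∧ᶠ leᶠ c d)

    minᶠ : FO₀ 1
    minᶠ = ∀ᶠ (¬ᶠ ltᶠ zero (suc zero))

    module _ {n k : ℕ} (ρ : Vec (Dom n) k) where
      open Intended {s} {n}

      ⟦_⟧₀ : FO₀ k → Set
      ⟦ φ ⟧₀ = ⟦ φ ⟧ᶠ emptyState noInterp ρ

      leᶠ-sem : ∀ a b → ⟦ leᶠ a b ⟧₀ ⇔ (toℕ (lookup ρ a) ≤ toℕ (lookup ρ b))
      leᶠ-sem a b = mk⇔ [ <⇒≤ , (λ eq → ≤-reflexive (cong toℕ eq)) ]′ ⇐
        where
        ⇐ : toℕ (lookup ρ a) ≤ toℕ (lookup ρ b) → ⟦ leᶠ a b ⟧₀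
        ⇐ a≤b with m≤n⇒m<n∨m≡n a≤b
        ... | inj₁ a<b = inj₁ a<b
        ... | inj₂ a≡b = inj₂ (toℕ-injective a≡b)

      withinᶠ-sem : ∀ y a b → ⟦ withinᶠ y a b ⟧₀ ⇔ Within (lookup ρ y) (lookup ρ a) (lookup ρ b)
      withinᶠ-sem y a b = leᶠ-sem a y ×-⇔ ⇔-id _

      orderedᶠ-sem : ∀ a b c d →
        ⟦ orderedᶠ a b c d ⟧₀ ⇔ Ordered (lookup ρ a) (lookup ρ b) (lookup ρ c) (lookup ρ d)
      orderedᶠ-sem a b c d = leᶠ-sem a b ×-⇔ leᶠ-sem b c ×-⇔ leᶠ-sem c d

      succᶠ-sem : ∀ a b → ⟦ succᶠ a b ⟧₀ ⇔ IsSucc (lookup ρ a) (lookup ρ b)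
      succᶠ-sem a b = mk⇔ ⇒ ⇐
        where
        A = toℕ (lookup ρ a)
        B = toℕ (lookup ρ b)
        ⇒ : ⟦ succᶠ a b ⟧₀ → B ≡ suc A
        ⇒ (A<B , nothing-between) with m≤n⇒m<n∨m≡n A<B
        ... | inj₂ eq    = sym eq
        ... | inj₁ A+1<B = ⊥-elim (nothing-between (fromℕ< A+1<n)
              (subst (A <_) (sym (toℕ-fromℕ< A+1<n)) ≤-refl ,
               subst (_< B) (sym (toℕ-fromℕ< A+1<n)) A+1<B))
          where
          A+1<n : suc A < suc n
          A+1<n = <-trans A+1<B (toℕ<n (lookup ρ b))
        ⇐ : B ≡ suc A → ⟦ succᶠ a b ⟧₀
        ⇐ eq = subst (A <_) (sym eq) ≤-refl ,
               λ d (A<d , d<B) → <-irrefl refl (≤-trans (subst (toℕ d <_) eq d<B) A<d)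

    minᶠ-sem : ∀ {n} (x : Dom n) → ⟦ minᶠ ⟧ᶠ emptyState noInterp (x ∷ []) ⇔ Intended.IsMin {s} {n} x
    minᶠ-sem x = mk⇔ ⇒ ⇐
      where
      ⇒ : ⟦ minᶠ ⟧ᶠ emptyState noInterp (x ∷ []) → toℕ x ≡ 0
      ⇒ nothing-below = n≤0⇒n≡0 (≮⇒≥ (nothing-below zero))
      ⇐ : toℕ x ≡ 0 → ⟦ minᶠ ⟧ᶠ emptyState noInterp (x ∷ [])
      ⇐ eq d d<x with () ← subst (toℕ d <_) eq d<x

open Relations

module DomainSplits {s n : ℕ} (f : ℕ → Maybe (Fin s)) where

  toℕ≤n : (x : Dom n) → toℕ x ≤ n
  toℕ≤n x = s≤s⁻¹ (toℕ<n x)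

  fromℕ≤ : ∀ {p} → p ≤ n → ∃[ x ] toℕ x ≡ p
  fromℕ≤ p≤n = fromℕ< (s≤s p≤n) , toℕ-fromℕ< (s≤s p≤n)

  SplitsAt : Dom n → Dom n → List (Fin s) → List (Fin s) → Set
  SplitsAt a b u v = Σ[ c ∈ Dom n ] toℕ a ≤ toℕ c × toℕ c ≤ toℕ b ×
    segment f (toℕ a) (toℕ c) ≡ u × segment f (toℕ c) (toℕ b) ≡ v

  SplitsAtLetter : Dom n → Dom n → List (Fin s) → Fin s → List (Fin s) → Set
  SplitsAtLetter a b u ζ v = Σ[ d ∈ Dom n ] Σ[ d′ ∈ Dom n ]
    toℕ d′ ≡ suc (toℕ d) × toℕ a ≤ toℕ d × toℕ d < toℕ b ×
    segment f (toℕ a) (toℕ d) ≡ u × f (toℕ d) ≡ just ζ × segment f (toℕ d′) (toℕ b) ≡ v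

  splitsAt : ∀ a b u v → toℕ a ≤ toℕ b → segment f (toℕ a) (toℕ b) ≡ u ++ v → SplitsAt a b u v
  splitsAt a b u v a≤b eq with segment-split f u v a≤b eq
  ... | c , a≤c , c≤b , eq₁ , eq₂ with fromℕ≤ (≤-trans c≤b (toℕ≤n b))
  ...   | c′ , refl = c′ , a≤c , c≤b , eq₁ , eq₂

  splitsAtLetter : ∀ a b u ζ v → toℕ a ≤ toℕ b → segment f (toℕ a) (toℕ b) ≡ u ++ ζ ∷ v →
    SplitsAtLetter a b u ζ v
  splitsAtLetter a b u ζ v a≤b eq with segment-split-letter f u ζ v a≤b eq
  ... | d , a≤d , d<b , eq₁ , fd , eq₂
    with fromℕ≤ (<⇒≤ (≤-trans d<b (toℕ≤n b))) | fromℕ≤ (≤-trans d<b (toℕ≤n b))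
  ...   | d′ , refl | d″ , d″≡ =
    d′ , d″ , d″≡ , a≤d , d<b , eq₁ , fd , subst (λ z → segment f z (toℕ b) ≡ v) (sym d″≡) eq₂

FactorsEqual-++ : ∀ {s n} (W : WordState s n) {a m b c m′ d} →
  Intended.FactorsEqual W a m c m′ → Intended.FactorsEqual W m b m′ d →
  segment (label W) (toℕ a) (toℕ b) ≡ segment (label W) (toℕ c) (toℕ d)
FactorsEqual-++ W {a} {m} {b} {c} {m′} {d} ((a≤m , _ , c≤m′) , eq₁) ((m≤b , _ , m′≤d) , eq₂) = begin
  w[ toℕ a , toℕ b ⟩                        ≡⟨ segment-++ _ a≤m m≤b ⟩
  w[ toℕ a , toℕ m ⟩ ++ w[ toℕ m , toℕ b ⟩   ≡⟨ cong₂ _++_ eq₁ eq₂ ⟩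
  w[ toℕ c , toℕ m′ ⟩ ++ w[ toℕ m′ , toℕ d ⟩ ≡⟨ segment-++ _ c≤m′ m′≤d ⟨
  w[ toℕ c , toℕ d ⟩                        ∎
  where
  open ≡-Reasoning
  w[_,_⟩ = segment (label W)

module UpdateAt {s n : ℕ} (W : WordState s n) (i : Fin n) where
  open Intended {s} {n}
  open DomainSplits {s} {n} (label W)
  open ≡-Reasoning

  y : Dom n
  y = inject₁ i

  Y : ℕ
  Y = toℕ y

  f : ℕ → Maybe (Fin s)
  f = label W

  f′ : Maybe (Fin s) → ℕ → Maybe (Fin s)
  f′ v = label (setPos W i v)

  Y<n : Y < n
  Y<n = subst (_< n) (sym (toℕ-inject₁ i)) (toℕ<n i)

  next : Dom n
  next = proj₁ (fromℕ≤ Y<n)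

  toℕ-next : toℕ next ≡ suc Y
  toℕ-next = proj₂ (fromℕ≤ Y<n)

  label-at-y : ∀ v → f′ v Y ≡ v
  label-at-y v = subst (λ p → f′ v p ≡ v) (sym (toℕ-inject₁ i)) (label-setPos-≡ W i v)

  label-off-y : ∀ v {p} → p ≢ Y → f′ v p ≡ f p
  label-off-y v p≢Y = label-setPos-≢ W i v (λ eq → p≢Y (trans eq (sym (toℕ-inject₁ i))))

  segment-off-y : ∀ v {a b} → a ≤ b → ¬ (a ≤ Y × Y < b) → segment (f′ v) a b ≡ segment f a b
  segment-off-y v a≤b y∉ab = segment-cong a≤b
    λ p a≤p p<b → label-off-y v λ { refl → y∉ab (a≤p , p<b) }

  segment-after-y : ∀ v {a b} → Y < a → a ≤ b → segment (f′ v) a b ≡ segment f a b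
  segment-after-y v Y<a a≤b = segment-off-y v a≤b λ (a≤Y , _) → <-irrefl refl (<-≤-trans Y<a a≤Y)

  segment-before-y : ∀ v {a b} → a ≤ b → b ≤ Y → segment (f′ v) a b ≡ segment f a b
  segment-before-y v a≤b b≤Y = segment-off-y v a≤b λ (_ , Y<b) → <-irrefl refl (<-≤-trans Y<b b≤Y)

  segment-around-y : ∀ v {a b} → a ≤ Y → Y < b →
    segment (f′ v) a b ≡ segment f a Y ++ fromMaybe v ++ segment f (suc Y) b
  segment-around-y v {a} {b} a≤Y Y<b = begin
    segment (f′ v) a b
      ≡⟨ segment-around (f′ v) a≤Y Y<b ⟩
    segment (f′ v) a Y ++ fromMaybe (f′ v Y) ++ segment (f′ v) (suc Y) b
      ≡⟨ cong₂ (λ u x → u ++ fromMaybe x ++ segment (f′ v) (suc Y) b)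
               (segment-before-y v a≤Y ≤-refl) (label-at-y v) ⟩
    segment f a Y ++ fromMaybe v ++ segment (f′ v) (suc Y) b
      ≡⟨ cong (λ u → segment f a Y ++ fromMaybe v ++ u) (segment-after-y v ≤-refl Y<b) ⟩
    segment f a Y ++ fromMaybe v ++ segment f (suc Y) b ∎

  within? : ∀ a b → Dec (Within y a b)
  within? a b = (toℕ a ≤? Y) ×-dec (Y <? toℕ b)

  ResetWitness : Dom n → Dom n → Dom n → Dom n → Set
  ResetWitness a b c d = Σ[ y₁ ∈ Dom n ] Σ[ y₁′ ∈ Dom n ] Σ[ y₂ ∈ Dom n ] Σ[ y₂′ ∈ Dom n ]
    ResetSplits y a b c d y₁ y₁′ y₂ y₂′ × FactorsEqual W a y₁ c y₂ × FactorsEqual W y₁′ b y₂′ d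

  ResetWitness⇒FactorsEqual : ∀ a b c d → ResetWitness a b c d →
    FactorsEqual (setPos W i nothing) a b c d
  ResetWitness⇒FactorsEqual a b c d
    (y₁ , y₁′ , y₂ , y₂′ , (ord@(_ , b≤c , c≤d) , inj₁ ((a≤Y , Y<b) , refl , y₁′≡ , refl)) ,
     ((_ , _ , c≤y₂) , eq₁) , ((_ , _ , y₂≤d) , eq₂)) =
    ord , (begin
      segment (f′ nothing) (toℕ a) (toℕ b)
        ≡⟨ segment-around-y nothing a≤Y Y<b ⟩
      segment f (toℕ a) Y ++ segment f (suc Y) (toℕ b)
        ≡⟨ cong₂ _++_ eq₁ (trans (cong (λ p → segment f p (toℕ b)) (sym y₁′≡)) eq₂) ⟩
      segment f (toℕ c) (toℕ y₂) ++ segment f (toℕ y₂) (toℕ d)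
        ≡⟨ segment-++ f c≤y₂ y₂≤d ⟨
      segment f (toℕ c) (toℕ d)
        ≡⟨ segment-after-y nothing (<-≤-trans Y<b b≤c) c≤d ⟨
      segment (f′ nothing) (toℕ c) (toℕ d) ∎)
  ResetWitness⇒FactorsEqual a b c d
    (y₁ , y₁′ , y₂ , y₂′ , (ord@(a≤b , b≤c , _) , inj₂ (inj₁ ((c≤Y , Y<d) , refl , y₂′≡ , refl))) ,
     ((a≤y₁ , _) , eq₁) , ((y₁≤b , _) , eq₂)) =
    ord , (begin
      segment (f′ nothing) (toℕ a) (toℕ b)
        ≡⟨ segment-before-y nothing a≤b (≤-trans b≤c c≤Y) ⟩
      segment f (toℕ a) (toℕ b)
        ≡⟨ segment-++ f a≤y₁ y₁≤b ⟩
      segment f (toℕ a) (toℕ y₁) ++ segment f (toℕ y₁) (toℕ b)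
        ≡⟨ cong₂ _++_ eq₁ (trans eq₂ (cong (λ p → segment f p (toℕ d)) y₂′≡)) ⟩
      segment f (toℕ c) Y ++ segment f (suc Y) (toℕ d)
        ≡⟨ segment-around-y nothing c≤Y Y<d ⟨
      segment (f′ nothing) (toℕ c) (toℕ d) ∎)
  ResetWitness⇒FactorsEqual a b c d
    (y₁ , y₁′ , y₂ , y₂′ , (ord@(a≤b , _ , c≤d) , inj₂ (inj₂ (y∉ab , y∉cd , refl , refl))) , eq₁ , eq₂) =
    ord , (begin
      segment (f′ nothing) (toℕ a) (toℕ b) ≡⟨ segment-off-y nothing a≤b y∉ab ⟩
      segment f (toℕ a) (toℕ b)            ≡⟨ FactorsEqual-++ W eq₁ eq₂ ⟩
      segment f (toℕ c) (toℕ d)            ≡⟨ segment-off-y nothing c≤d y∉cd ⟨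
      segment (f′ nothing) (toℕ c) (toℕ d) ∎)

  FactorsEqual⇒ResetWitness : ∀ a b c d → FactorsEqual (setPos W i nothing) a b c d →
    ResetWitness a b c d
  FactorsEqual⇒ResetWitness a b c d (ord@(a≤b , b≤c , c≤d) , eq) with within? a b | within? c d
  ... | yes (a≤Y , Y<b) | _ = witness (splitsAt c d _ _ c≤d (begin
    segment f (toℕ c) (toℕ d)
      ≡⟨ segment-after-y nothing (<-≤-trans Y<b b≤c) c≤d ⟨
    segment (f′ nothing) (toℕ c) (toℕ d)
      ≡⟨ eq ⟨
    segment (f′ nothing) (toℕ a) (toℕ b)
      ≡⟨ segment-around-y nothing a≤Y Y<b ⟩
    segment f (toℕ a) Y ++ segment f (suc Y) (toℕ b) ∎))
    where
    witness : SplitsAt c d (segment f (toℕ a) Y) (segment f (suc Y) (toℕ b)) → ResetWitness a b c d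
    witness (e , c≤e , e≤d , eq₁ , eq₂) =
      y , next , e , e , (ord , inj₁ ((a≤Y , Y<b) , refl , toℕ-next , refl)) ,
      ((a≤Y , <⇒≤ (<-≤-trans Y<b b≤c) , c≤e) , sym eq₁) ,
      ((subst (_≤ toℕ b) (sym toℕ-next) Y<b , ≤-trans b≤c c≤e , e≤d) ,
       trans (cong (λ p → segment f p (toℕ b)) toℕ-next) (sym eq₂))
  ... | no y∉ab | yes (c≤Y , Y<d) = witness (splitsAt a b _ _ a≤b (begin
    segment f (toℕ a) (toℕ b)
      ≡⟨ segment-before-y nothing a≤b (≤-trans b≤c c≤Y) ⟨
    segment (f′ nothing) (toℕ a) (toℕ b)
      ≡⟨ eq ⟩
    segment (f′ nothing) (toℕ c) (toℕ d)
      ≡⟨ segment-around-y nothing c≤Y Y<d ⟩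
    segment f (toℕ c) Y ++ segment f (suc Y) (toℕ d) ∎))
    where
    witness : SplitsAt a b (segment f (toℕ c) Y) (segment f (suc Y) (toℕ d)) → ResetWitness a b c d
    witness (e , a≤e , e≤b , eq₁ , eq₂) =
      e , e , y , next , (ord , inj₂ (inj₁ ((c≤Y , Y<d) , refl , toℕ-next , refl))) ,
      ((a≤e , ≤-trans e≤b b≤c , c≤Y) , eq₁) ,
      ((e≤b , subst (toℕ b ≤_) (sym toℕ-next) (m≤n⇒m≤1+n (≤-trans b≤c c≤Y)) ,
        subst (_≤ toℕ d) (sym toℕ-next) Y<d) ,
       trans eq₂ (cong (λ p → segment f p (toℕ d)) (sym toℕ-next)))
  ... | no y∉ab | no y∉cd =
    a , a , c , c , (ord , inj₂ (inj₂ (y∉ab , y∉cd , refl , refl))) ,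
    ((≤-refl , ≤-trans a≤b b≤c , ≤-refl) , trans (segment-refl f (toℕ a)) (sym (segment-refl f (toℕ c)))) ,
    (ord , trans (sym (segment-off-y nothing a≤b y∉ab)) (trans eq (segment-off-y nothing c≤d y∉cd)))

  module Insert (ζ : Fin s) where

    W′ : WordState s n
    W′ = setPos W i (just ζ)

    InsertWitness : Dom n → Dom n → Dom n → Dom n → Set
    InsertWitness a b c d =
      Σ[ y₁ ∈ Dom n ] Σ[ y₁′ ∈ Dom n ] Σ[ y₂ ∈ Dom n ] Σ[ y₂′ ∈ Dom n ] Σ[ e ∈ Dom n ]
      InsertSplits y a b c d y₁ y₁′ y₂ y₂′ e ×
      FactorsEqual W a y₁ c y₂ × FactorsEqual W y₁′ b y₂′ d × Lab W′ ζ e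

    Lab-off-y : ∀ {p} → toℕ p ≢ Y → Lab W′ ζ p ⇔ (f (toℕ p) ≡ just ζ)
    Lab-off-y {p} p≢Y = mk⇔
      (λ l → trans (sym (label-off-y (just ζ) p≢Y)) (to (Lab⇔label W′ ζ p) l))
      (λ fp → from (Lab⇔label W′ ζ p) (trans (label-off-y (just ζ) p≢Y) fp))

    InsertWitness⇒FactorsEqual : ∀ a b c d → InsertWitness a b c d → FactorsEqual W′ a b c d
    InsertWitness⇒FactorsEqual a b c d
      (y₁ , y₁′ , y₂ , y₂′ , e , (ord@(a≤b , b≤c , c≤d) , inj₁ ((a≤Y , Y<b) , refl , y₁′≡ , refl , y₂′≡)) ,
       ((_ , _ , c≤e) , eq₁) , ((_ , _ , y₂′≤d) , eq₂) , ζ-at-e) =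
      ord , (begin
        segment (f′ (just ζ)) (toℕ a) (toℕ b)
          ≡⟨ segment-around-y (just ζ) a≤Y Y<b ⟩
        segment f (toℕ a) Y ++ ζ ∷ segment f (suc Y) (toℕ b)
          ≡⟨ cong₂ (λ u w → u ++ ζ ∷ w) eq₁ (trans (cong (λ p → segment f p (toℕ b)) (sym y₁′≡))
                                                   (trans eq₂ (cong (λ p → segment f p (toℕ d)) y₂′≡))) ⟩
        segment f (toℕ c) (toℕ e) ++ ζ ∷ segment f (suc (toℕ e)) (toℕ d)
          ≡⟨ segment-around-just f c≤e (subst (_≤ toℕ d) y₂′≡ y₂′≤d) fe ⟨
        segment f (toℕ c) (toℕ d)
          ≡⟨ segment-after-y (just ζ) (<-≤-trans Y<b b≤c) c≤d ⟨
        segment (f′ (just ζ)) (toℕ c) (toℕ d) ∎)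
      where
      fe : f (toℕ e) ≡ just ζ
      fe = to (Lab-off-y (>⇒≢ (<-≤-trans Y<b (≤-trans b≤c c≤e)))) ζ-at-e
    InsertWitness⇒FactorsEqual a b c d
      (y₁ , y₁′ , y₂ , y₂′ , e , (ord@(a≤b , b≤c , c≤d) , inj₂ (inj₁ ((c≤Y , Y<d) , refl , y₂′≡ , refl , y₁′≡))) ,
       ((a≤e , _) , eq₁) , ((y₁′≤b , _) , eq₂) , ζ-at-e) =
      ord , (begin
        segment (f′ (just ζ)) (toℕ a) (toℕ b)
          ≡⟨ segment-before-y (just ζ) a≤b (≤-trans b≤c c≤Y) ⟩
        segment f (toℕ a) (toℕ b)
          ≡⟨ segment-around-just f a≤e e<b fe ⟩
        segment f (toℕ a) (toℕ e) ++ ζ ∷ segment f (suc (toℕ e)) (toℕ b)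
          ≡⟨ cong₂ (λ u w → u ++ ζ ∷ w) eq₁ (trans (cong (λ p → segment f p (toℕ b)) (sym y₁′≡))
                                                   (trans eq₂ (cong (λ p → segment f p (toℕ d)) y₂′≡))) ⟩
        segment f (toℕ c) Y ++ ζ ∷ segment f (suc Y) (toℕ d)
          ≡⟨ segment-around-y (just ζ) c≤Y Y<d ⟨
        segment (f′ (just ζ)) (toℕ c) (toℕ d) ∎)
      where
      e<b : toℕ e < toℕ b
      e<b = subst (_≤ toℕ b) y₁′≡ y₁′≤b
      fe : f (toℕ e) ≡ just ζ
      fe = to (Lab-off-y (<⇒≢ (<-≤-trans e<b (≤-trans b≤c c≤Y)))) ζ-at-e
    InsertWitness⇒FactorsEqual a b c d
      (y₁ , y₁′ , y₂ , y₂′ , e , (ord@(a≤b , _ , c≤d) , inj₂ (inj₂ (y∉ab , y∉cd , refl , refl , refl))) ,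
       eq₁ , eq₂ , _) =
      ord , (begin
        segment (f′ (just ζ)) (toℕ a) (toℕ b) ≡⟨ segment-off-y (just ζ) a≤b y∉ab ⟩
        segment f (toℕ a) (toℕ b)             ≡⟨ FactorsEqual-++ W eq₁ eq₂ ⟩
        segment f (toℕ c) (toℕ d)             ≡⟨ segment-off-y (just ζ) c≤d y∉cd ⟨
        segment (f′ (just ζ)) (toℕ c) (toℕ d) ∎)

    FactorsEqual⇒InsertWitness : ∀ a b c d → FactorsEqual W′ a b c d → InsertWitness a b c d
    FactorsEqual⇒InsertWitness a b c d (ord@(a≤b , b≤c , c≤d) , eq) with within? a b | within? c d
    ... | yes (a≤Y , Y<b) | _ = witness (splitsAtLetter c d _ ζ _ c≤d (begin
      segment f (toℕ c) (toℕ d)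
        ≡⟨ segment-after-y (just ζ) (<-≤-trans Y<b b≤c) c≤d ⟨
      segment (f′ (just ζ)) (toℕ c) (toℕ d)
        ≡⟨ eq ⟨
      segment (f′ (just ζ)) (toℕ a) (toℕ b)
        ≡⟨ segment-around-y (just ζ) a≤Y Y<b ⟩
      segment f (toℕ a) Y ++ ζ ∷ segment f (suc Y) (toℕ b) ∎))
      where
      witness : SplitsAtLetter c d (segment f (toℕ a) Y) ζ (segment f (suc Y) (toℕ b)) →
        InsertWitness a b c d
      witness (e , e′ , toℕ-e′ , c≤e , e<d , eq₁ , fe , eq₂) =
        y , next , e , e′ , e , (ord , inj₁ ((a≤Y , Y<b) , refl , toℕ-next , refl , toℕ-e′)) ,
        ((a≤Y , <⇒≤ (<-≤-trans Y<b b≤c) , c≤e) , sym eq₁) ,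
        ((subst (_≤ toℕ b) (sym toℕ-next) Y<b ,
          subst (toℕ b ≤_) (sym toℕ-e′) (m≤n⇒m≤1+n (≤-trans b≤c c≤e)) ,
          subst (_≤ toℕ d) (sym toℕ-e′) e<d) ,
         trans (cong (λ p → segment f p (toℕ b)) toℕ-next) (sym eq₂)) ,
        from (Lab-off-y (>⇒≢ (<-≤-trans Y<b (≤-trans b≤c c≤e)))) fe
    ... | no y∉ab | yes (c≤Y , Y<d) = witness (splitsAtLetter a b _ ζ _ a≤b (begin
      segment f (toℕ a) (toℕ b)
        ≡⟨ segment-before-y (just ζ) a≤b (≤-trans b≤c c≤Y) ⟨
      segment (f′ (just ζ)) (toℕ a) (toℕ b)
        ≡⟨ eq ⟩
      segment (f′ (just ζ)) (toℕ c) (toℕ d)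
        ≡⟨ segment-around-y (just ζ) c≤Y Y<d ⟩
      segment f (toℕ c) Y ++ ζ ∷ segment f (suc Y) (toℕ d) ∎))
      where
      witness : SplitsAtLetter a b (segment f (toℕ c) Y) ζ (segment f (suc Y) (toℕ d)) →
        InsertWitness a b c d
      witness (e , e′ , toℕ-e′ , a≤e , e<b , eq₁ , fe , eq₂) =
        e , e′ , y , next , e , (ord , inj₂ (inj₁ ((c≤Y , Y<d) , refl , toℕ-next , refl , toℕ-e′))) ,
        ((a≤e , <⇒≤ (<-≤-trans e<b b≤c) , c≤Y) , eq₁) ,
        ((subst (_≤ toℕ b) (sym toℕ-e′) e<b ,
          subst (toℕ b ≤_) (sym toℕ-next) (m≤n⇒m≤1+n (≤-trans b≤c c≤Y)) ,
          subst (_≤ toℕ d) (sym toℕ-next) Y<d) ,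
         trans eq₂ (cong (λ p → segment f p (toℕ d)) (sym toℕ-next))) ,
        from (Lab-off-y (<⇒≢ (<-≤-trans e<b (≤-trans b≤c c≤Y)))) fe
    ... | no y∉ab | no y∉cd =
      a , a , c , c , y , (ord , inj₂ (inj₂ (y∉ab , y∉cd , refl , refl , refl))) ,
      ((≤-refl , ≤-trans a≤b b≤c , ≤-refl) , trans (segment-refl f (toℕ a)) (sym (segment-refl f (toℕ c)))) ,
      (ord , trans (sym (segment-off-y (just ζ) a≤b y∉ab)) (trans eq (segment-off-y (just ζ) c≤d y∉cd))) ,
      from (Lab⇔label W′ ζ y) (label-at-y (just ζ))

  $≢y : $ ≢ y
  $≢y $≡y = <-irrefl refl (subst (_< n) (trans (cong toℕ (sym $≡y)) (toℕ-fromℕ n)) Y<n)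

  IsMarked-off-y : ∀ v {x} → x ≢ y → IsMarked (setPos W i v) x ⇔ IsMarked W x
  IsMarked-off-y v {x} x≢y = ⇔-id _ ⊎-⇔ mk⇔
    (λ (ζ , eq) → ζ , trans (sym f′x≡fx) eq)
    (λ (ζ , eq) → ζ , trans f′x≡fx eq)
    where
    f′x≡fx : f′ v (toℕ x) ≡ f (toℕ x)
    f′x≡fx = label-off-y v (λ eq → x≢y (toℕ-injective eq))

  IsMarked-reset : ∀ x → (IsMarked W x × x ≢ y) ⇔ IsMarked (setPos W i nothing) x
  IsMarked-reset x = mk⇔ (λ (marked , x≢y) → from (IsMarked-off-y nothing x≢y) marked) ⇐
    where
    ⇐ : IsMarked (setPos W i nothing) x → IsMarked W x × x ≢ y
    ⇐ (inj₁ refl)       = inj₁ refl , $≢y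
    ⇐ (inj₂ (ζ , eq)) = to (IsMarked-off-y nothing x≢y) (inj₂ (ζ , eq)) , x≢y
      where
      x≢y : x ≢ y
      x≢y refl with () ← trans (sym (label-at-y nothing)) eq

  IsMarked-insert : ∀ ζ x →
    (Σ[ u ∈ Dom n ] Selects x y u × IsMarked W u) ⇔ IsMarked (setPos W i (just ζ)) x
  IsMarked-insert ζ x = mk⇔ ⇒ ⇐
    where
    ⇒ : Σ[ u ∈ Dom n ] Selects x y u × IsMarked W u → IsMarked (setPos W i (just ζ)) x
    ⇒ (u , inj₁ (refl , _)     , _)      = inj₂ (ζ , label-at-y (just ζ))
    ⇒ (u , inj₂ (x≢y , refl) , marked) = from (IsMarked-off-y (just ζ) x≢y) marked
    ⇐ : IsMarked (setPos W i (just ζ)) x → Σ[ u ∈ Dom n ] Selects x y u × IsMarked W u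
    ⇐ marked with x Data.Fin.≟ y
    ... | yes x≡y = $ , inj₁ (x≡y , refl) , inj₁ refl
    ... | no  x≢y = x , inj₂ (x≢y , refl) , to (IsMarked-off-y (just ζ) x≢y) marked

module Program {s : ℕ} where
  open FOFormulas {s}

  CQ₉ : ℕ → Set
  CQ₉ = CQ s 9 arity

  R : ∀ {k} (j : Fin 9) → Vec (Term k) (arity j) → CQ₉ k
  R j ts = atom (rel j ts)

  -- Pattern variable x ↦ the pair of query variables delimiting the factor it was bound to.
  VarBinding : ℕ → Set
  VarBinding k = List (ℕ × (Fin k × Fin k))

  lookupVar : ∀ {k} → VarBinding k → ℕ → Maybe (Fin k × Fin k)
  lookupVar []              x = nothing
  lookupVar ((y , ab) ∷ E) x with x ≟ y
  ... | yes _ = just ab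
  ... | no  _ = lookupVar E x

  weaken : ∀ {k} → VarBinding k → VarBinding (suc k)
  weaken = map λ (x , a , b) → x , suc a , suc b

  weaken₂ : ∀ {k} → VarBinding k → VarBinding (suc (suc k))
  weaken₂ E = weaken (weaken E)

  factorEqAfter : Maybe (Fin s) → ∀ {k} → (y a b c d : Fin k) → CQ₉ k
  factorEqAfter nothing y a b c d = ∃ᶜ (∃ᶜ (∃ᶜ (∃ᶜ (
    R ResetSplit (↑ y ∷ ↑ a ∷ ↑ b ∷ ↑ c ∷ ↑ d ∷ var (# 3) ∷ var (# 2) ∷ var (# 1) ∷ var (# 0) ∷ []) ∧ᶜ
    (R FactorEq (↑ a ∷ var (# 3) ∷ ↑ c ∷ var (# 1) ∷ []) ∧ᶜ
     R FactorEq (var (# 2) ∷ ↑ b ∷ var (# 0) ∷ ↑ d ∷ []))))))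
    where
    ↑ : ∀ {k} → Fin k → Term (4 + k)
    ↑ x = var (suc (suc (suc (suc x))))
  factorEqAfter (just ζ) y a b c d = ∃ᶜ (∃ᶜ (∃ᶜ (∃ᶜ (∃ᶜ (
    R InsertSplit (↑ y ∷ ↑ a ∷ ↑ b ∷ ↑ c ∷ ↑ d ∷
                   var (# 4) ∷ var (# 3) ∷ var (# 2) ∷ var (# 1) ∷ var (# 0) ∷ []) ∧ᶜ
    (R FactorEq (↑ a ∷ var (# 4) ∷ ↑ c ∷ var (# 2) ∷ []) ∧ᶜ
    (R FactorEq (var (# 3) ∷ ↑ b ∷ var (# 1) ∷ ↑ d ∷ []) ∧ᶜ atom (lab ζ (var (# 0))))))))))
    where
    ↑ : ∀ {k} → Fin k → Term (5 + k)
    ↑ x = var (suc (suc (suc (suc (suc x)))))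

  markedAfter : Maybe (Fin s) → ∀ {k} → (y x : Fin k) → CQ₉ k
  markedAfter nothing  y x = R Marked (var x ∷ []) ∧ᶜ R Neq (var x ∷ var y ∷ [])
  markedAfter (just ζ) y x =
    ∃ᶜ (R Select (var (suc x) ∷ var (suc y) ∷ var zero ∷ []) ∧ᶜ R Marked (var zero ∷ []))

  -- matchQuery op α E last y p: the suffix of the updated word from position p matches α under E;
  -- last is bound to $ and y to the update position.
  mutual
    matchQuery : Maybe (Fin s) → Pattern s → ∀ {k} → VarBinding k → (last y p : Fin k) → CQ₉ k
    matchQuery op []            E last y p = factorEqAfter op y p last last last
    matchQuery op (inj₁ a ∷ α) E last y p = ∃ᶜ (∃ᶜ (
      factorEqAfter op (suc (suc y)) (suc (suc p)) (# 1) (suc (suc last)) (suc (suc last)) ∧ᶜ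
      (atom (lab a (var (# 1))) ∧ᶜ
      (R Succ (var (# 1) ∷ var (# 0) ∷ []) ∧ᶜ
       matchQuery op α (weaken₂ E) (suc (suc last)) (suc (suc y)) (# 0)))))
    matchQuery op (inj₂ x ∷ α) E last y p = matchVarQuery op x α E last y p (lookupVar E x)

    matchVarQuery : Maybe (Fin s) → ℕ → Pattern s → ∀ {k} → VarBinding k → (last y p : Fin k) →
      Maybe (Fin k × Fin k) → CQ₉ k
    matchVarQuery op x α E last y p (just (a , b)) = ∃ᶜ (
      factorEqAfter op (suc y) (suc a) (suc b) (suc p) (# 0) ∧ᶜ
      matchQuery op α (weaken E) (suc last) (suc y) (# 0))
    matchVarQuery op x α E last y p nothing = ∃ᶜ (∃ᶜ (
      factorEqAfter op (suc (suc y)) (suc (suc p)) (# 0) (suc (suc last)) (suc (suc last)) ∧ᶜ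
      (markedAfter op (suc (suc y)) (# 0) ∧ᶜ
      (atom (var (# 0) ≺ var (# 1)) ∧ᶜ
       matchQuery op α ((x , suc (suc p) , # 1) ∷ weaken₂ E) (suc (suc last)) (suc (suc y)) (# 1)))))

  acceptQuery : Maybe (Fin s) → Pattern s → CQ₉ 1
  acceptQuery op α =
    ∃ᶜ (atom (var (# 0) ≐ dollar) ∧ᶜ ∃ᶜ (R Min (var (# 0) ∷ []) ∧ᶜ matchQuery op α [] (# 1) (# 2) (# 0)))

  unchanged : (j : Fin 9) → CQ₉ (suc (arity j))
  unchanged j = R j (tabulate λ l → var (suc l))

  update : Pattern s → Maybe (Fin s) → (j : Fin 9) → CQ₉ (suc (arity j))
  update α op Accept   = acceptQuery op α
  update α op FactorEq = factorEqAfter op (# 0) (# 1) (# 2) (# 3) (# 4)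
  update α op Marked   = markedAfter op (# 0) (# 1)
  update α op j        = unchanged j

  initial : (j : Fin 9) → FO₀ (arity j)
  initial Accept      = atom (dollar ≺ dollar)
  initial FactorEq    = orderedᶠ (# 0) (# 1) (# 2) (# 3)
  initial Marked      = atom (var (# 0) ≐ dollar)
  initial Succ        = succᶠ (# 0) (# 1)
  initial Min         = minᶠ
  initial Neq         = ¬ᶠ eqᶠ (# 0) (# 1)
  initial Select      =
    (eqᶠ (# 0) (# 1) ∧ᶠ atom (var (# 2) ≐ dollar)) ∨ᶠ ((¬ᶠ eqᶠ (# 0) (# 1)) ∧ᶠ eqᶠ (# 2) (# 0))
  initial ResetSplit  =
    orderedᶠ (# 1) (# 2) (# 3) (# 4) ∧ᶠ
    ((withinᶠ (# 0) (# 1) (# 2) ∧ᶠ (eqᶠ (# 5) (# 0) ∧ᶠ (succᶠ (# 0) (# 6) ∧ᶠ eqᶠ (# 8) (# 7)))) ∨ᶠ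
     ((withinᶠ (# 0) (# 3) (# 4) ∧ᶠ (eqᶠ (# 7) (# 0) ∧ᶠ (succᶠ (# 0) (# 8) ∧ᶠ eqᶠ (# 6) (# 5)))) ∨ᶠ
      ((¬ᶠ withinᶠ (# 0) (# 1) (# 2)) ∧ᶠ
       ((¬ᶠ withinᶠ (# 0) (# 3) (# 4)) ∧ᶠ (eqᶠ (# 6) (# 5) ∧ᶠ eqᶠ (# 8) (# 7))))))
  initial InsertSplit =
    orderedᶠ (# 1) (# 2) (# 3) (# 4) ∧ᶠ
    ((withinᶠ (# 0) (# 1) (# 2) ∧ᶠ
      (eqᶠ (# 5) (# 0) ∧ᶠ (succᶠ (# 0) (# 6) ∧ᶠ (eqᶠ (# 9) (# 7) ∧ᶠ succᶠ (# 7) (# 8))))) ∨ᶠ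
     ((withinᶠ (# 0) (# 3) (# 4) ∧ᶠ
       (eqᶠ (# 7) (# 0) ∧ᶠ (succᶠ (# 0) (# 8) ∧ᶠ (eqᶠ (# 9) (# 5) ∧ᶠ succᶠ (# 5) (# 6))))) ∨ᶠ
      ((¬ᶠ withinᶠ (# 0) (# 1) (# 2)) ∧ᶠ
       ((¬ᶠ withinᶠ (# 0) (# 3) (# 4)) ∧ᶠ (eqᶠ (# 6) (# 5) ∧ᶠ (eqᶠ (# 8) (# 7) ∧ᶠ eqᶠ (# 9) (# 0)))))))

  program : Pattern s → DynCQProgram s
  program α = record
    { m = 9 ; ar = arity ; init = initial ; update = update α ; query = Accept ; query0 = refl }

module Correctness {s : ℕ} (α : Pattern s) {n : ℕ} where
  open Intended {s} {n}
  open FOFormulas {s}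
  open Program {s}

  record Invariant (W : WordState s n) (I : AuxInterp n 9 arity) : Set where
    field
      accept      : I Accept [] ⇔ L-NE α (word W)
      factorEq    : ∀ a b c d → I FactorEq (a ∷ b ∷ c ∷ d ∷ []) ⇔ FactorsEqual W a b c d
      marked      : ∀ a → I Marked (a ∷ []) ⇔ IsMarked W a
      succ        : ∀ a b → I Succ (a ∷ b ∷ []) ⇔ IsSucc a b
      min         : ∀ a → I Min (a ∷ []) ⇔ IsMin a
      neq         : ∀ a b → I Neq (a ∷ b ∷ []) ⇔ (a ≢ b)
      select      : ∀ a b c → I Select (a ∷ b ∷ c ∷ []) ⇔ Selects a b c
      resetSplit  : ∀ y a b c d y₁ y₁′ y₂ y₂′ →
        I ResetSplit (y ∷ a ∷ b ∷ c ∷ d ∷ y₁ ∷ y₁′ ∷ y₂ ∷ y₂′ ∷ []) ⇔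
        ResetSplits y a b c d y₁ y₁′ y₂ y₂′
      insertSplit : ∀ y a b c d y₁ y₁′ y₂ y₂′ e →
        I InsertSplit (y ∷ a ∷ b ∷ c ∷ d ∷ y₁ ∷ y₁′ ∷ y₂ ∷ y₂′ ∷ e ∷ []) ⇔
        InsertSplits y a b c d y₁ y₁′ y₂ y₂′ e

  module Step {W : WordState s n} {I : AuxInterp n 9 arity} (inv : Invariant W I) (i : Fin n) where
    open Invariant inv
    open UpdateAt W i

    module _ {k : ℕ} (ρ : Vec (Dom n) k) {y′ : Fin k} (y′↦y : lookup ρ y′ ≡ y) where

      factorEqAfter-sem : ∀ v a b c d → ⟦ factorEqAfter v y′ a b c d ⟧ᶜ (setPos W i v) I ρ ⇔
        FactorsEqual (setPos W i v) (lookup ρ a) (lookup ρ b) (lookup ρ c) (lookup ρ d)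
      factorEqAfter-sem nothing a b c d = ⇔-trans
        (∃-⇔ λ y₁ → ∃-⇔ λ y₁′ → ∃-⇔ λ y₂ → ∃-⇔ λ y₂′ →
          splits y′↦y y₁ y₁′ y₂ y₂′ ×-⇔ factorEq A y₁ C y₂ ×-⇔ factorEq y₁′ B y₂′ D)
        (mk⇔ (ResetWitness⇒FactorsEqual A B C D) (FactorsEqual⇒ResetWitness A B C D))
        where
        A = lookup ρ a ; B = lookup ρ b ; C = lookup ρ c ; D = lookup ρ d
        splits : ∀ {u} → u ≡ y → ∀ y₁ y₁′ y₂ y₂′ →
          I ResetSplit (u ∷ A ∷ B ∷ C ∷ D ∷ y₁ ∷ y₁′ ∷ y₂ ∷ y₂′ ∷ []) ⇔
          ResetSplits y A B C D y₁ y₁′ y₂ y₂′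
        splits refl = resetSplit y A B C D
      factorEqAfter-sem (just ζ) a b c d = ⇔-trans
        (∃-⇔ λ y₁ → ∃-⇔ λ y₁′ → ∃-⇔ λ y₂ → ∃-⇔ λ y₂′ → ∃-⇔ λ e →
          splits y′↦y y₁ y₁′ y₂ y₂′ e ×-⇔ factorEq A y₁ C y₂ ×-⇔ factorEq y₁′ B y₂′ D ×-⇔ ⇔-id _)
        (mk⇔ (InsertWitness⇒FactorsEqual A B C D) (FactorsEqual⇒InsertWitness A B C D))
        where
        open Insert ζ
        A = lookup ρ a ; B = lookup ρ b ; C = lookup ρ c ; D = lookup ρ d
        splits : ∀ {u} → u ≡ y → ∀ y₁ y₁′ y₂ y₂′ e →
          I InsertSplit (u ∷ A ∷ B ∷ C ∷ D ∷ y₁ ∷ y₁′ ∷ y₂ ∷ y₂′ ∷ e ∷ []) ⇔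
          InsertSplits y A B C D y₁ y₁′ y₂ y₂′ e
        splits refl = insertSplit y A B C D

      markedAfter-sem : ∀ v x →
        ⟦ markedAfter v y′ x ⟧ᶜ (setPos W i v) I ρ ⇔ IsMarked (setPos W i v) (lookup ρ x)
      markedAfter-sem nothing x = ⇔-trans (marked X ×-⇔ neq-y) (IsMarked-reset X)
        where
        X = lookup ρ x
        neq-y : I Neq (X ∷ lookup ρ y′ ∷ []) ⇔ (X ≢ y)
        neq-y = subst (λ u → I Neq (X ∷ u ∷ []) ⇔ (X ≢ y)) (sym y′↦y) (neq X y)
      markedAfter-sem (just ζ) x = ⇔-trans (∃-⇔ λ u → select-y u ×-⇔ marked u) (IsMarked-insert ζ X)
        where
        X = lookup ρ x
        select-y : ∀ u → I Select (X ∷ lookup ρ y′ ∷ u ∷ []) ⇔ Selects X y u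
        select-y u = subst (λ w → I Select (X ∷ w ∷ u ∷ []) ⇔ Selects X y u) (sym y′↦y) (select X y u)

    toℕ≤toℕ$ : ∀ (x : Dom n) → toℕ x ≤ toℕ $
    toℕ≤toℕ$ x = subst (toℕ x ≤_) (sym (toℕ-fromℕ n)) (DomainSplits.toℕ≤n {s} {n} (label W) x)

    module Match (v : Maybe (Fin s)) where

      W′ : WordState s n
      W′ = setPos W i v

      g : ℕ → Maybe (Fin s)
      g = label W′

      suffix : Dom n → List (Fin s)
      suffix p = segment g (toℕ p) (toℕ $)

      record Frame (k : ℕ) : Set where
        field
          env    : Vec (Dom n) k
          last   : Fin k
          upd    : Fin k
          last↦$ : lookup env last ≡ $
          upd↦y  : lookup env upd ≡ y

      infixl 5 _▸_
      _▸_ : ∀ {k} → Frame k → Dom n → Frame (suc k)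
      F ▸ d = record
        { env = d ∷ env ; last = suc last ; upd = suc upd ; last↦$ = last↦$ ; upd↦y = upd↦y }
        where open Frame F

      factorOf : ∀ {k} → Vec (Dom n) k → Fin k × Fin k → Word
      factorOf ρ (a , b) = segment g (toℕ (lookup ρ a)) (toℕ (lookup ρ b))

      bindingOf : ∀ {k} → Vec (Dom n) k → VarBinding k → Binding
      bindingOf ρ []              = []
      bindingOf ρ ((x , ab) ∷ E) = (x , factorOf ρ ab) ∷ bindingOf ρ E

      bindingOf-weaken : ∀ {k} d (ρ : Vec (Dom n) k) E → bindingOf (d ∷ ρ) (weaken E) ≡ bindingOf ρ E
      bindingOf-weaken d ρ []              = refl
      bindingOf-weaken d ρ ((x , ab) ∷ E) = cong (_ ∷_) (bindingOf-weaken d ρ E)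

      bindingOf-weaken₂ : ∀ {k} d d′ (ρ : Vec (Dom n) k) E →
        bindingOf (d′ ∷ d ∷ ρ) (weaken₂ E) ≡ bindingOf ρ E
      bindingOf-weaken₂ d d′ ρ E = trans (bindingOf-weaken d′ (d ∷ ρ) (weaken E)) (bindingOf-weaken d ρ E)

      lookup-bindingOf : ∀ {k} (ρ : Vec (Dom n) k) E x →
        lookupBinding (bindingOf ρ E) x ≡ Data.Maybe.map (factorOf ρ) (lookupVar E x)
      lookup-bindingOf ρ []              x = refl
      lookup-bindingOf ρ ((y , ab) ∷ E) x with x ≟ y
      ... | yes _ = refl
      ... | no  _ = lookup-bindingOf ρ E x

      -- Bound factors end before P, which makes FactorEq(a, b, p, q) applicable to them.
      BoundedBy : ∀ {k} → Vec (Dom n) k → VarBinding k → ℕ → Set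
      BoundedBy ρ []                   P = ⊤
      BoundedBy ρ ((x , a , b) ∷ E) P =
        (toℕ (lookup ρ a) ≤ toℕ (lookup ρ b) × toℕ (lookup ρ b) ≤ P) × BoundedBy ρ E P

      BoundedBy-weaken : ∀ {k} d (ρ : Vec (Dom n) k) E {P} →
        BoundedBy ρ E P → BoundedBy (d ∷ ρ) (weaken E) P
      BoundedBy-weaken d ρ []              bnd         = bnd
      BoundedBy-weaken d ρ ((x , ab) ∷ E) (ab≤ , bnd) = ab≤ , BoundedBy-weaken d ρ E bnd

      BoundedBy-weaken₂ : ∀ {k} d d′ (ρ : Vec (Dom n) k) E {P} → BoundedBy ρ E P →
        BoundedBy (d′ ∷ d ∷ ρ) (weaken₂ E) P
      BoundedBy-weaken₂ d d′ ρ E bnd = BoundedBy-weaken d′ (d ∷ ρ) (weaken E) (BoundedBy-weaken d ρ E bnd)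

      BoundedBy-mono : ∀ {k} (ρ : Vec (Dom n) k) E {P P′} → P ≤ P′ → BoundedBy ρ E P → BoundedBy ρ E P′
      BoundedBy-mono ρ []              P≤P′ bnd                 = bnd
      BoundedBy-mono ρ ((x , ab) ∷ E) P≤P′ ((a≤b , b≤P) , bnd) =
        (a≤b , ≤-trans b≤P P≤P′) , BoundedBy-mono ρ E P≤P′ bnd

      BoundedBy-lookup : ∀ {k} (ρ : Vec (Dom n) k) E {P} x {a b} →
        BoundedBy ρ E P → lookupVar E x ≡ just (a , b) →
        toℕ (lookup ρ a) ≤ toℕ (lookup ρ b) × toℕ (lookup ρ b) ≤ P
      BoundedBy-lookup ρ ((y , _) ∷ E) x (ab≤ , bnd) eq with x ≟ y
      BoundedBy-lookup ρ ((y , _) ∷ E) x (ab≤ , bnd) refl | yes _ = ab≤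
      ... | no _ = BoundedBy-lookup ρ E x bnd eq

      FactorsEqual-empty : ∀ {a b L} → L ≡ $ →
        FactorsEqual W′ a b L L ⇔ (toℕ a ≤ toℕ b × segment g (toℕ a) (toℕ b) ≡ [])
      FactorsEqual-empty {a} {b} refl = mk⇔
        (λ ((a≤b , _) , eq) → a≤b , trans eq (segment-refl g (toℕ $)))
        (λ (a≤b , eq) → (a≤b , toℕ≤toℕ$ b , ≤-refl) , trans eq (sym (segment-refl g (toℕ $))))

      Gap : Dom n → Dom n → Set
      Gap a b = toℕ a ≤ toℕ b × segment g (toℕ a) (toℕ b) ≡ []

      gap-sem : ∀ {k} (F : Frame k) (p z : Fin k) → let open Frame F in
        ⟦ factorEqAfter v upd p z last last ⟧ᶜ W′ I env ⇔ Gap (lookup env p) (lookup env z)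
      gap-sem F p z = ⇔-trans (factorEqAfter-sem env upd↦y v p z last last) (FactorsEqual-empty last↦$)
        where open Frame F

      suffix-letter : ∀ {P z z′ a} → Gap P z → g (toℕ z) ≡ just a → toℕ z′ ≡ suc (toℕ z) →
        suffix P ≡ a ∷ suffix z′
      suffix-letter {P} {z} {z′} {a} (P≤z , empty) gz z′≡ = begin
        suffix P
          ≡⟨ segment-around-just g P≤z (subst (_≤ toℕ $) z′≡ (toℕ≤toℕ$ z′)) gz ⟩
        segment g (toℕ P) (toℕ z) ++ a ∷ segment g (suc (toℕ z)) (toℕ $)
          ≡⟨ cong₂ (λ u q → u ++ a ∷ segment g q (toℕ $)) empty (sym z′≡) ⟩
        a ∷ suffix z′ ∎
        where open ≡-Reasoning

      -- z < q excludes z = $, so the marked position z carries a letter.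
      nonempty-factor : ∀ {P z q : Dom n} → Gap P z → toℕ z < toℕ q → IsMarked W′ z →
        segment g (toℕ P) (toℕ q) ≢ []
      nonempty-factor {z = z} {q} _ z<q (inj₁ refl) _ = <-irrefl refl (<-≤-trans z<q (toℕ≤toℕ$ q))
      nonempty-factor {P} {z} {q} (P≤z , empty) z<q (inj₂ (ζ , gz)) Pq≡[]
        with () ← trans (sym (trans (segment-around-just g P≤z z<q gz) (cong (_++ _) empty))) Pq≡[]

      rebind : ∀ {X : Set} (α : Pattern s) (w : Word) {B B′ : Binding} → B ≡ B′ →
        X ⇔ Matches α B w → X ⇔ Matches α B′ w
      rebind α w refl X⇔M = X⇔M

      MatchSem : Pattern s → Set
      MatchSem α = ∀ {k} (F : Frame k) E p → let open Frame F in
        BoundedBy env E (toℕ (lookup env p)) →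
        ⟦ matchQuery v α E last upd p ⟧ᶜ W′ I env ⇔ Matches α (bindingOf env E) (suffix (lookup env p))

      match-[] : MatchSem []
      match-[] F E p _ = ⇔-trans (gap-sem F p last) (gap⇔suffix last↦$)
        where
        open Frame F
        P = lookup env p
        gap⇔suffix : ∀ {L} → L ≡ $ → Gap P L ⇔ (suffix P ≡ [])
        gap⇔suffix refl = mk⇔ proj₂ (toℕ≤toℕ$ P ,_)

      match-letter : ∀ a {α} → MatchSem α → MatchSem (inj₁ a ∷ α)
      match-letter a {α} ih F E p bnd = mk⇔ ⇒ ⇐
        where
        open Frame F
        open DomainSplits {s} {n} g using (splitsAtLetter)
        P = lookup env p
        B = bindingOf env E
        IH : ∀ z z′ → toℕ P ≤ toℕ z′ →
          ⟦ matchQuery v α (weaken₂ E) (suc (suc last)) (suc (suc upd)) (# 0) ⟧ᶜ W′ I (z′ ∷ z ∷ env) ⇔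
          Matches α B (suffix z′)
        IH z z′ P≤z′ = rebind α (suffix z′) (bindingOf-weaken₂ z z′ env E)
          (ih (F ▸ z ▸ z′) (weaken₂ E) (# 0) (BoundedBy-weaken₂ z z′ env E (BoundedBy-mono env E P≤z′ bnd)))
        ⇒ : ⟦ matchQuery v (inj₁ a ∷ α) E last upd p ⟧ᶜ W′ I env → Matches (inj₁ a ∷ α) B (suffix P)
        ⇒ (z , z′ , gap , ζ-at-z , z↝z′ , m) =
          suffix z′ , suffix-letter gap′ (to (Lab⇔label W′ a z) ζ-at-z) z′≡ ,
          to (IH z z′ (subst (toℕ P ≤_) (sym z′≡) (m≤n⇒m≤1+n (proj₁ gap′)))) m
          where
          gap′ = to (gap-sem (F ▸ z ▸ z′) (suc (suc p)) (# 1)) gap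
          z′≡ = to (succ z z′) z↝z′
        ⇐ : Matches (inj₁ a ∷ α) B (suffix P) → ⟦ matchQuery v (inj₁ a ∷ α) E last upd p ⟧ᶜ W′ I env
        ⇐ (w′ , suffix-P , m) with splitsAtLetter P $ [] a w′ (toℕ≤toℕ$ P) suffix-P
        ... | z , z′ , z′≡ , P≤z , _ , empty , gz , suffix-z′ =
          z , z′ , from (gap-sem (F ▸ z ▸ z′) (suc (suc p)) (# 1)) (P≤z , empty) ,
          from (Lab⇔label W′ a z) gz , from (succ z z′) z′≡ ,
          from (IH z z′ (subst (toℕ P ≤_) (sym z′≡) (m≤n⇒m≤1+n P≤z)))
               (subst (Matches α B) (sym suffix-z′) m)

      match-bound : ∀ x {α} → MatchSem α → ∀ {k} (F : Frame k) E p {a b} → let open Frame F in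
        BoundedBy env E (toℕ (lookup env p)) → lookupVar E x ≡ just (a , b) →
        ⟦ matchVarQuery v x α E last upd p (just (a , b)) ⟧ᶜ W′ I env ⇔
        MatchesVar x α (bindingOf env E) (suffix (lookup env p)) (just (factorOf env (a , b)))
      match-bound x {α} ih F E p {a} {b} bnd x↦ab = mk⇔ ⇒ ⇐
        where
        open Frame F
        open DomainSplits {s} {n} g using (splitsAt)
        P = lookup env p
        B = bindingOf env E
        u = factorOf env (a , b)
        IH : ∀ q → toℕ P ≤ toℕ q →
          ⟦ matchQuery v α (weaken E) (suc last) (suc upd) (# 0) ⟧ᶜ W′ I (q ∷ env) ⇔ Matches α B (suffix q)
        IH q P≤q = rebind α (suffix q) (bindingOf-weaken q env E)
          (ih (F ▸ q) (weaken E) (# 0) (BoundedBy-weaken q env E (BoundedBy-mono env E P≤q bnd)))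
        ⇒ : ⟦ matchVarQuery v x α E last upd p (just (a , b)) ⟧ᶜ W′ I env →
          MatchesVar x α B (suffix P) (just u)
        ⇒ (q , fe , m) with to (factorEqAfter-sem (q ∷ env) upd↦y v _ _ _ _) fe
        ... | (_ , _ , P≤q) , u≡Pq =
          suffix q , trans (segment-++ g P≤q (toℕ≤toℕ$ q)) (cong (_++ suffix q) (sym u≡Pq)) ,
          to (IH q P≤q) m
        ⇐ : MatchesVar x α B (suffix P) (just u) →
          ⟦ matchVarQuery v x α E last upd p (just (a , b)) ⟧ᶜ W′ I env
        ⇐ (w′ , suffix-P , m) with splitsAt P $ u w′ (toℕ≤toℕ$ P) suffix-P
        ... | q , P≤q , _ , Pq≡u , suffix-q =
          q , from (factorEqAfter-sem (q ∷ env) upd↦y v _ _ _ _) ((a≤b , b≤P , P≤q) , sym Pq≡u) ,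
          from (IH q P≤q) (subst (Matches α B) (sym suffix-q) m)
          where
          a≤b = proj₁ (BoundedBy-lookup env E x bnd x↦ab)
          b≤P = proj₂ (BoundedBy-lookup env E x bnd x↦ab)

      match-fresh : ∀ x {α} → MatchSem α → ∀ {k} (F : Frame k) E p → let open Frame F in
        BoundedBy env E (toℕ (lookup env p)) →
        ⟦ matchVarQuery v x α E last upd p nothing ⟧ᶜ W′ I env ⇔
        MatchesVar x α (bindingOf env E) (suffix (lookup env p)) nothing
      match-fresh x {α} ih F E p bnd = mk⇔ ⇒ ⇐
        where
        open Frame F
        open DomainSplits {s} {n} g using (splitsAt; splitsAtLetter)
        P = lookup env p
        B = bindingOf env E
        E′ = (x , suc (suc p) , # 1) ∷ weaken₂ E
        IH : ∀ z q → toℕ P ≤ toℕ q →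
          ⟦ matchQuery v α E′ (suc (suc last)) (suc (suc upd)) (# 1) ⟧ᶜ W′ I (z ∷ q ∷ env) ⇔
          Matches α ((x , segment g (toℕ P) (toℕ q)) ∷ B) (suffix q)
        IH z q P≤q = rebind α (suffix q) (cong (_ ∷_) (bindingOf-weaken₂ q z env E))
          (ih (F ▸ q ▸ z) E′ (# 1)
            ((P≤q , ≤-refl) , BoundedBy-weaken₂ q z env E (BoundedBy-mono env E P≤q bnd)))
        ⇒ : ⟦ matchVarQuery v x α E last upd p nothing ⟧ᶜ W′ I env → MatchesVar x α B (suffix P) nothing
        ⇒ (q , z , gap , marked , z<q , m) =
          segment g (toℕ P) (toℕ q) , suffix q ,
          nonempty-factor gap′ z<q (to (markedAfter-sem (z ∷ q ∷ env) upd↦y v _) marked) ,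
          segment-++ g P≤q (toℕ≤toℕ$ q) , to (IH z q P≤q) m
          where
          gap′ = to (gap-sem (F ▸ q ▸ z) (suc (suc p)) (# 0)) gap
          P≤q = ≤-trans (proj₁ gap′) (<⇒≤ z<q)
        ⇐ : MatchesVar x α B (suffix P) nothing → ⟦ matchVarQuery v x α E last upd p nothing ⟧ᶜ W′ I env
        ⇐ ([] , _ , u≢[] , _) = ⊥-elim (u≢[] refl)
        ⇐ (ζ ∷ u , w′ , _ , suffix-P , m) with splitsAt P $ (ζ ∷ u) w′ (toℕ≤toℕ$ P) suffix-P
        ... | q , P≤q , _ , Pq≡ζu , suffix-q with splitsAtLetter P q [] ζ u P≤q Pq≡ζu
        ...   | z , _ , _ , P≤z , z<q , empty , gz , _ =
          q , z , from (gap-sem (F ▸ q ▸ z) (suc (suc p)) (# 0)) (P≤z , empty) ,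
          from (markedAfter-sem (z ∷ q ∷ env) upd↦y v _) (inj₂ (ζ , gz)) , z<q ,
          from (IH z q P≤q)
               (subst₂ (λ u′ w → Matches α ((x , u′) ∷ B) w) (sym Pq≡ζu) (sym suffix-q) m)

      matchQuery-sem : ∀ α → MatchSem α
      matchQuery-sem []            = match-[]
      matchQuery-sem (inj₁ a ∷ α) = match-letter a {α} (matchQuery-sem α)
      matchQuery-sem (inj₂ x ∷ α) F E p bnd =
        subst (λ m → ⟦ matchVarQuery v x α E last upd p (lookupVar E x) ⟧ᶜ W′ I env ⇔
                     MatchesVar x α (bindingOf env E) (suffix (lookup env p)) m)
              (sym (lookup-bindingOf env E x))
              (matchVar (lookupVar E x) refl)
        where
        open Frame F
        matchVar : ∀ m → lookupVar E x ≡ m → ⟦ matchVarQuery v x α E last upd p m ⟧ᶜ W′ I env ⇔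
          MatchesVar x α (bindingOf env E) (suffix (lookup env p)) (Data.Maybe.map (factorOf env) m)
        matchVar (just (a , b)) x↦ab = match-bound x {α} (matchQuery-sem α) F E p bnd x↦ab
        matchVar nothing        _    = match-fresh x {α} (matchQuery-sem α) F E p bnd

      acceptQuery-sem : α ≢ [] → ⟦ acceptQuery v α ⟧ᶜ W′ I (y ∷ []) ⇔ L-NE α (word W′)
      acceptQuery-sem α≢[] = mk⇔ ⇒ ⇐
        where
        word≡suffix : ∀ {p} → I Min (p ∷ []) → word W′ ≡ suffix p
        word≡suffix {p} min-p = begin
          word W′       ≡⟨ word≡segment W′ ⟩
          segment g 0 n ≡⟨ cong₂ (segment g) (sym (to (min p) min-p)) (sym (toℕ-fromℕ n)) ⟩
          suffix p      ∎
          where open ≡-Reasoning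
        initialFrame : ∀ {L p} → L ≡ $ → Frame 3
        initialFrame {L} {p} L≡$ = record
          { env = p ∷ L ∷ y ∷ [] ; last = # 1 ; upd = # 2 ; last↦$ = L≡$ ; upd↦y = refl }
        ⇒ : ⟦ acceptQuery v α ⟧ᶜ W′ I (y ∷ []) → L-NE α (word W′)
        ⇒ (L , L≡$ , p , min-p , m) = from (L-NE⇔Matches α (word W′) α≢[])
          (subst (Matches α []) (sym (word≡suffix min-p))
            (to (matchQuery-sem α (initialFrame {p = p} L≡$) [] (# 0) _) m))
        ⇐ : L-NE α (word W′) → ⟦ acceptQuery v α ⟧ᶜ W′ I (y ∷ [])
        ⇐ l = $ , refl , zero , from (min zero) refl ,
          from (matchQuery-sem α (initialFrame {p = zero} refl) [] (# 0) _)
            (subst (Matches α []) (word≡suffix (from (min zero) refl))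
              (to (L-NE⇔Matches α (word W′) α≢[]) l))

    preserves : α ≢ [] → ∀ v → Invariant (setPos W i v) (stepAux (program α) v i (setPos W i v) I)
    preserves α≢[] v = record
      { accept      = acceptQuery-sem α≢[]
      ; factorEq    = λ a b c d → factorEqAfter-sem (y ∷ a ∷ b ∷ c ∷ d ∷ []) refl v (# 1) (# 2) (# 3) (# 4)
      ; marked      = λ a → markedAfter-sem (y ∷ a ∷ []) refl v (# 1)
      ; succ        = succ
      ; min         = min
      ; neq         = neq
      ; select      = select
      ; resetSplit  = resetSplit
      ; insertSplit = insertSplit
      }
      where open Match v

  initially : α ≢ [] → Invariant emptyState (initAux (program α))
  initially α≢[] = record
    { accept      = mk⇔ (λ $<$ → ⊥-elim (<-irrefl refl $<$)) λ l → ⊥-elim (Matches-nonempty α α≢[]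
                      (subst (Matches α []) word-emptyState (to (L-NE⇔Matches α _ α≢[]) l)))
    ; factorEq    = λ a b c d → let ordered = orderedᶠ-sem (a ∷ b ∷ c ∷ d ∷ []) (# 0) (# 1) (# 2) (# 3) in
                      mk⇔ (λ ord → to ordered ord , segments-empty a b c d) (λ (ord , _) → from ordered ord)
    ; marked      = λ a → mk⇔ inj₁ λ { (inj₁ a≡$) → a≡$ ; (inj₂ (ζ , eq)) → ⊥-elim (no-letter a eq) }
    ; succ        = λ a b → succᶠ-sem (a ∷ b ∷ []) (# 0) (# 1)
    ; min         = minᶠ-sem
    ; neq         = λ a b → ⇔-id _
    ; select      = λ a b c → ⇔-id _
    ; resetSplit  = resetSplit-sem
    ; insertSplit = insertSplit-sem
    }
    where
    word-emptyState : word {s} {n} emptyState ≡ []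
    word-emptyState = trans (word≡segment {n = n} emptyState) (segment-emptyState {n = n} 0 n)

    segments-empty : ∀ (a b c d : Dom n) →
      segment (label {n = n} emptyState) (toℕ a) (toℕ b) ≡
      segment (label {n = n} emptyState) (toℕ c) (toℕ d)
    segments-empty a b c d =
      trans (segment-emptyState {n = n} (toℕ a) (toℕ b))
            (sym (segment-emptyState {n = n} (toℕ c) (toℕ d)))

    no-letter : ∀ (a : Dom n) {ζ} → label {n = n} emptyState (toℕ a) ≢ just ζ
    no-letter a eq with () ← trans (sym (label-emptyState {n = n} (toℕ a))) eq

    resetSplit-sem : ∀ y a b c d y₁ y₁′ y₂ y₂′ →
      ⟦ initial ResetSplit ⟧ᶠ emptyState noInterp (y ∷ a ∷ b ∷ c ∷ d ∷ y₁ ∷ y₁′ ∷ y₂ ∷ y₂′ ∷ []) ⇔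
      ResetSplits y a b c d y₁ y₁′ y₂ y₂′
    resetSplit-sem y a b c d y₁ y₁′ y₂ y₂′ =
      orderedᶠ-sem ρ (# 1) (# 2) (# 3) (# 4) ×-⇔
      ((y∈ab ×-⇔ ⇔-id _ ×-⇔ succᶠ-sem ρ (# 0) (# 6) ×-⇔ ⇔-id _) ⊎-⇔
       (y∈cd ×-⇔ ⇔-id _ ×-⇔ succᶠ-sem ρ (# 0) (# 8) ×-⇔ ⇔-id _) ⊎-⇔
       (¬-cong-⇔ y∈ab ×-⇔ ¬-cong-⇔ y∈cd ×-⇔ ⇔-id _))
      where
      ρ = y ∷ a ∷ b ∷ c ∷ d ∷ y₁ ∷ y₁′ ∷ y₂ ∷ y₂′ ∷ []
      y∈ab = withinᶠ-sem ρ (# 0) (# 1) (# 2)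
      y∈cd = withinᶠ-sem ρ (# 0) (# 3) (# 4)

    insertSplit-sem : ∀ y a b c d y₁ y₁′ y₂ y₂′ e →
      ⟦ initial InsertSplit ⟧ᶠ emptyState noInterp (y ∷ a ∷ b ∷ c ∷ d ∷ y₁ ∷ y₁′ ∷ y₂ ∷ y₂′ ∷ e ∷ []) ⇔
      InsertSplits y a b c d y₁ y₁′ y₂ y₂′ e
    insertSplit-sem y a b c d y₁ y₁′ y₂ y₂′ e =
      orderedᶠ-sem ρ (# 1) (# 2) (# 3) (# 4) ×-⇔
      ((y∈ab ×-⇔ ⇔-id _ ×-⇔ succᶠ-sem ρ (# 0) (# 6) ×-⇔ ⇔-id _ ×-⇔ succᶠ-sem ρ (# 7) (# 8)) ⊎-⇔
       (y∈cd ×-⇔ ⇔-id _ ×-⇔ succᶠ-sem ρ (# 0) (# 8) ×-⇔ ⇔-id _ ×-⇔ succᶠ-sem ρ (# 5) (# 6)) ⊎-⇔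
       (¬-cong-⇔ y∈ab ×-⇔ ¬-cong-⇔ y∈cd ×-⇔ ⇔-id _))
      where
      ρ = y ∷ a ∷ b ∷ c ∷ d ∷ y₁ ∷ y₁′ ∷ y₂ ∷ y₂′ ∷ e ∷ []
      y∈ab = withinᶠ-sem ρ (# 0) (# 1) (# 2)
      y∈cd = withinᶠ-sem ρ (# 0) (# 3) (# 4)

  reachable⇒invariant : α ≢ [] → ∀ {W I} → Reachable (program α) n W I → Invariant W I
  reachable⇒invariant α≢[] start             = initially α≢[]
  reachable⇒invariant α≢[] (step r op i _) = Step.preserves (reachable⇒invariant α≢[] r) i α≢[] op

lemma3p9 : (s : ℕ) (α : Pattern s) → α ≢ [] → InDynCQ (L-NE α)
lemma3p9 s α α≢[] = program α , maintained
  where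
  open Program {s}
  maintained : Maintains (program α) (L-NE α)
  maintained n W I reachable = ⇔-sym (Invariant.accept (reachable⇒invariant α≢[] reachable))
    where open Correctness α {n}
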